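{- Let $n,k\ge1$ and $m\ge0$ be integers. The map $\psi=\psi_r\circ\psi_b$ defined below is a bijection from $\mathcal{C}_n^k(m,*,|m+1)$ onto $\mathcal{C}_{n-1}^{k-1}(m+1)$.
   Context: Blue and red are two distinct colours. For integers $m,k,n\ge0$, the blue ground set is $K=\{m+1,\dots,m+k\}\cup\{*_b\}$ and the red ground set is $N=\{m+1,\dots,m+n\}\cup\{*_r\}$. A (shifted) Callan sequence of size $k\times n$ is a sequence of pairs $(B_1,R_1)\cdots(B_r,R_r)(B^*,R^*)$, $r\ge0$, such that $\{B_1,\dots,B_r,B^*\}$ is a set partition of $K$ into $r+1$ nonempty blocks with $*_b\in B^*$, and $\{R_1,\dots,R_r,R^*\}$ is a set partition of $N$ into $r+1$ nonempty blocks with $*_r\in R^*$; $(B_i,R_i)$ are ordinary pairs, $(B^*,R^*)$ is the extra pair. An $m$-barred Callan sequence of size $k\times n$ is a linear arrangement of $m$ blue bars labelled $1,\dots,m$, $m+1$ red bars labelled $0,\dots,m$, and the pairs of a shifted Callan sequence of size $k\times n$ in the order of that Callan sequence, such that every blue bar with label $i$ is immediately followed by a bar with label strictly smaller than $i$, and every red bar with label $i$ is immediately followed either by a Callan pair or by a bar with label strictly greater than $i$. $\mathcal{C}_n^k(m)$ is the set of these (so $\mathcal{C}_{n-1}^{k-1}(m+1)$ uses blue elements $m+2,\dots,m+k$, red elements $m+2,\dots,m+n$, blue bars $1,\dots,m+1$, red bars $0,\dots,m+1$). $\mathcal{C}_n^k(m,*,|m+1)$ is the set of $\alpha\in\mathcal{C}_n^k(m)$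 whose extra red block is $\{*_r\}$, in which the minimal blue element $m+1$ forms by itself the blue block of an ordinary pair $(\{m+1\},R)$, and this pair is immediately preceded by at least one bar. $\psi_b(\alpha)$: let $w_1$ (nonempty) and $w_2$ (possibly empty) be the maximal runs of consecutive bars immediately to the left and to the right of $(\{m+1\},R)$. Replace the segment $w_1\,(\{m+1\},R)\,w_2$ by $w_2\,\beta\,w_1$, where $\beta$ is a new blue bar with label $m+1$, and replace the extra red block $\{*_r\}$ by $R\cup\{*_r\}$. $\psi_r$ applied to $\gamma=\psi_b(\alpha)$ (extra pair $(B^*,R^*)$): if the red element $m+1$ lies in $R^*$, replace the extra pair by a new red bar with label $m+1$ immediately followed by $(B^*,R^*\setminus\{m+1\})$. Otherwise $m+1\in R_i$ for an ordinary pair $(B_i,R_i)$: replace $(B_i,R_i)$ by a new red bar with label $m+1$ immediately followed by $(B_i,R^*\setminus\{*_r\})$, and replace the extra pair by $(B^*,(R_i\setminus\{m+1\})\cup\{*_r\})$. -}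

module Defs where

open import Data.Nat using (ℕ; zero; suc; _+_; _<_; _≡ᵇ_)
open import Data.Bool using (Bool; true; false; not; if_then_else_; _∨_)
open import Data.List using (List; []; _∷_; _++_; reverse; applyUpTo; upTo)
open import Data.List.Relation.Unary.All using (All)
open import Data.List.Relation.Unary.Linked using (Linked)
open import Data.List.Relation.Binary.Permutation.Propositional using (_↭_)
open import Data.Maybe using (Maybe; just; nothing)
open import Data.Product using (_×_; _,_; Σ; ∃)
open import Data.Unit using (⊤)
open import Data.Empty using (⊥)
open import Relation.Binary.PropositionalEquality using (_≡_; _≢_)

-- Blocks (subsets of ℕ) are
-- represented canonically as strictly increasing lists, so that propositional
-- equality of lists is equality of sets.  The star elements *_b, *_r are kept
-- implicit: the item  extra B R  stands for the extra pair
-- (B ∪ {*_b}, R ∪ {*_r}), i.e. B, R are the non-star parts (possibly empty).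

data Item : Set where
  bbar  : ℕ → Item
  rbar  : ℕ → Item
  pair  : List ℕ → List ℕ → Item
  extra : List ℕ → List ℕ → Item

Seq : Set
Seq = List Item

IsBar : Item → Set
IsBar (bbar _) = ⊤
IsBar (rbar _) = ⊤
IsBar (pair _ _) = ⊥
IsBar (extra _ _) = ⊥

NotExtra : Item → Set
NotExtra (extra _ _) = ⊥
NotExtra _ = ⊤

blueLabels : Seq → List ℕ
blueLabels [] = []
blueLabels (bbar i ∷ s) = i ∷ blueLabels s
blueLabels (_ ∷ s) = blueLabels s

redLabels : Seq → List ℕ
redLabels [] = []
redLabels (rbar i ∷ s) = i ∷ redLabels s
redLabels (_ ∷ s) = redLabels s

blueElems : Seq → List ℕ
blueElems [] = []
blueElems (pair B _ ∷ s) = B ++ blueElems s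
blueElems (extra B _ ∷ s) = B ++ blueElems s
blueElems (_ ∷ s) = blueElems s

redElems : Seq → List ℕ
redElems [] = []
redElems (pair _ R ∷ s) = R ++ redElems s
redElems (extra _ R ∷ s) = R ++ redElems s
redElems (_ ∷ s) = redElems s

ItemOK : Item → Set
ItemOK (pair B R) = B ≢ [] × R ≢ [] × Linked _<_ B × Linked _<_ R
ItemOK (extra B R) = Linked _<_ B × Linked _<_ R
ItemOK _ = ⊤

Follows : Item → Seq → Set
Follows (bbar i) (bbar j ∷ _) = j < i
Follows (bbar i) (rbar j ∷ _) = j < i
Follows (bbar i) _ = ⊥
Follows (rbar i) (bbar j ∷ _) = i < j
Follows (rbar i) (rbar j ∷ _) = i < j
Follows (rbar i) (pair _ _ ∷ _) = ⊤
Follows (rbar i) (extra _ _ ∷ _) = ⊤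
Follows (rbar i) [] = ⊥
Follows _ _ = ⊤

BarsOK : Seq → Set
BarsOK [] = ⊤
BarsOK (x ∷ s) = Follows x s × BarsOK s

range : ℕ → ℕ → List ℕ
range a c = applyUpTo (λ i → suc (a + i)) c

-- α ∈ C_n^k(m)
IsBarred : ℕ → ℕ → ℕ → Seq → Set
IsBarred m k n s =
  (Σ Seq λ pre → Σ (List ℕ) λ B → Σ (List ℕ) λ R → Σ Seq λ post →
     (s ≡ pre ++ extra B R ∷ post) × All NotExtra pre × All IsBar post)
  × All ItemOK s
  × (blueElems s ↭ range m k)
  × (redElems s ↭ range m n)
  × (blueLabels s ↭ applyUpTo suc m)
  × (redLabels s ↭ upTo (suc m))
  × BarsOK s

-- α ∈ C_n^k(m, *, |m+1)
InDomain : ℕ → ℕ → ℕ → Seq → Set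
InDomain m k n s =
  IsBarred m k n s
  × (Σ Seq λ pre → Σ (List ℕ) λ B → Σ Seq λ post → s ≡ pre ++ extra B [] ∷ post)
  × (Σ Seq λ pre → Σ Item λ b → Σ (List ℕ) λ R → Σ Seq λ post →
       IsBar b × (s ≡ pre ++ b ∷ pair (suc m ∷ []) R ∷ post))

isBar : Item → Bool
isBar (bbar _) = true
isBar (rbar _) = true
isBar _ = false

elemᵇ : ℕ → List ℕ → Bool
elemᵇ x [] = false
elemᵇ x (y ∷ ys) = (y ≡ᵇ x) ∨ elemᵇ x ys

removeᵇ : ℕ → List ℕ → List ℕ
removeᵇ x [] = []
removeᵇ x (y ∷ ys) = if y ≡ᵇ x then removeᵇ x ys else y ∷ removeᵇ x ys

takeBars : Seq → Seq × Seq
takeBars [] = [] , []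
takeBars (x ∷ xs) with isBar x | takeBars xs
... | true  | (a , b) = x ∷ a , b
... | false | _       = [] , x ∷ xs

findBluePair : ℕ → Seq → Maybe (Seq × List ℕ × Seq)
findBluePair a [] = nothing
findBluePair a (pair (b ∷ []) R ∷ s) with b ≡ᵇ a | findBluePair a s
... | true  | _ = just ([] , R , s)
... | false | just (p , R' , q) = just (pair (b ∷ []) R ∷ p , R' , q)
... | false | nothing = nothing
findBluePair a (x ∷ s) with findBluePair a s
... | just (p , R , q) = just (x ∷ p , R , q)
... | nothing = nothing

findRedPair : ℕ → Seq → Maybe (Seq × List ℕ × List ℕ × Seq)
findRedPair a [] = nothing
findRedPair a (pair B R ∷ s) with elemᵇ a R | findRedPair a s
... | true  | _ = just ([] , B , R , s)
... | false | just (p , B' , R' , q) = just (pair B R ∷ p , B' , R' , q)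
... | false | nothing = nothing
findRedPair a (x ∷ s) with findRedPair a s
... | just (p , B , R , q) = just (x ∷ p , B , R , q)
... | nothing = nothing

getExtra : Seq → Maybe (List ℕ × List ℕ)
getExtra [] = nothing
getExtra (extra B R ∷ _) = just (B , R)
getExtra (_ ∷ s) = getExtra s

mapExtra : (List ℕ → List ℕ → Seq) → Seq → Seq
mapExtra f [] = []
mapExtra f (extra B R ∷ s) = f B R ++ mapExtra f s
mapExtra f (x ∷ s) = x ∷ mapExtra f s

setExtraRed : List ℕ → Seq → Seq
setExtraRed R = mapExtra (λ B _ → extra B R ∷ [])

ψb : ℕ → Seq → Seq
ψb m s with findBluePair (suc m) s
... | nothing = s
... | just (pre , R , post) with takeBars (reverse pre) | takeBars post
...   | (w1r , prer) | (w2 , post') =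
  setExtraRed R (reverse prer ++ w2 ++ bbar (suc m) ∷ reverse w1r ++ post')

ψr : ℕ → Seq → Seq
ψr m γ with getExtra γ
... | nothing = γ
... | just (Bs , Rs) with elemᵇ (suc m) Rs
...   | true = mapExtra (λ B R → rbar (suc m) ∷ extra B (removeᵇ (suc m) R) ∷ []) γ
...   | false with findRedPair (suc m) γ
...     | nothing = γ
...     | just (pre , Bi , Ri , post) =
  setExtraRed (removeᵇ (suc m) Ri) (pre ++ rbar (suc m) ∷ pair Bi Rs ∷ post)

ψ : ℕ → Seq → Seq
ψ m s = ψr m (ψb m s)

-- ψ is inverted one step at a time. ψ_b is undone by cutting at the blue bar m+1, swapping the
-- maximal bar runs on its two sides back and returning the extra red block to the pair ({m+1}, R);
-- ψ_r is undone by cutting at the red bar m+1 and putting m+1 back into the red block of the item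
-- after it, the extra pair or an ordinary pair whose red block is exchanged with the extra one.
-- Between the steps lie the sequences with blue bars 1..m+1, red bars 0..m and a nonempty extra
-- red block. Each step and its inverse keep the blocks and bar labels partitioned since they only
-- move bar runs and red blocks, and keep the bar conditions since the only new neighbours are at
-- the new bar m+1, the largest label of its colour, and at the seams of the moved bar runs.

module Submission where

open import Defs
open import Data.Nat using (ℕ; zero; suc; _+_; _<_; _≤_; _≡ᵇ_; s≤s)
open import Data.Nat.Properties
  using (<-irrefl; <-trans; ≤-<-trans; <-≤-trans; n<1+n; +-suc; +-identityʳ; m≤m+n; _≟_)
open import Data.Bool using (true; false; if_then_else_)
open import Data.List using (List; []; _∷_; _++_; _∷ʳ_; reverse; applyUpTo; upTo; map; drop)
open import Data.List.Properties
  using (++-assoc; ++-identityʳ; reverse-++; reverse-involutive; unfold-reverse;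
         ++-conicalˡ; ++-conicalʳ; ∷-injective; ∷ʳ-injectiveʳ; applyUpTo-∷ʳ; upTo-∷ʳ)
open import Data.List.Relation.Unary.All as All using (All; []; _∷_)
import Data.List.Relation.Unary.All.Properties as All
open import Data.List.Relation.Unary.Any using (here; there)
open import Data.List.Relation.Unary.Linked as Linked using (Linked; []; [-]; _∷_)
import Data.List.Relation.Unary.Linked.Properties as Linked
open import Data.List.Relation.Binary.Permutation.Propositional
  using (_↭_; prep; ↭-sym; ↭-trans)
import Data.List.Relation.Binary.Permutation.Propositional.Properties as ↭
open import Data.List.Membership.Propositional using (_∈_; _∉_)
open import Data.List.Membership.Propositional.Properties
  using (∈-++⁺ˡ; ∈-++⁺ʳ; ∈-++⁻; ∈-applyUpTo⁺; ∈-applyUpTo⁻; ∈-upTo⁺; ∈-upTo⁻)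
open import Data.List.Membership.DecPropositional _≟_ using (_∈?_)
open import Data.Maybe using (Maybe; just; nothing)
open import Data.Product using (Σ; ∃; ∃₂; _×_; _,_; proj₁; proj₂)
open import Data.Sum using (_⊎_; inj₁; inj₂; [_,_]′)
open import Data.Unit using (⊤; tt)
open import Data.Empty using (⊥-elim)
open import Data.Fin using (zero; suc)
open import Data.Vec using ([]; _∷_)
open import Relation.Binary.PropositionalEquality
open import Relation.Nullary using (¬_; yes; no)
open import Algebra.Solver.CommutativeMonoid (↭.++-commutativeMonoid {A = ℕ})
  using (prove; var; _⊕_)

module _ {A : Set} where

  ++-≡-∷ʳ : ∀ (xs ys zs : List A) e → xs ++ ys ≡ zs ∷ʳ e →
    (ys ≡ [] × xs ≡ zs ∷ʳ e) ⊎ ∃ λ ys₀ → ys ≡ ys₀ ∷ʳ e × zs ≡ xs ++ ys₀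
  ++-≡-∷ʳ [] [] [] e ()
  ++-≡-∷ʳ [] [] (z ∷ zs) e ()
  ++-≡-∷ʳ [] (y ∷ ys) zs e eq = inj₂ (zs , eq , refl)
  ++-≡-∷ʳ (x ∷ xs) ys [] e eq with ∷-injective eq
  ... | refl , eq′ with ++-conicalˡ xs ys eq′ | ++-conicalʳ xs ys eq′
  ... | refl | refl = inj₁ (refl , refl)
  ++-≡-∷ʳ (x ∷ xs) ys (z ∷ zs) e eq with ∷-injective eq
  ... | refl , eq′ with ++-≡-∷ʳ xs ys zs e eq′
  ... | inj₁ (p , q) = inj₁ (p , cong (x ∷_) q)
  ... | inj₂ (ys₀ , p , q) = inj₂ (ys₀ , p , cong (x ∷_) q)

  ∷-hole-≡-∷ʳ : ∀ P (x : A) Q body e → x ≢ e → P ++ x ∷ Q ≡ body ∷ʳ e →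
    ∃ λ Q₀ → Q ≡ Q₀ ∷ʳ e × body ≡ (P ∷ʳ x) ++ Q₀
  ∷-hole-≡-∷ʳ P x Q body e x≢e eq with ++-≡-∷ʳ (P ∷ʳ x) Q body e (trans (++-assoc P (x ∷ []) Q) eq)
  ... | inj₁ (_ , P∷ʳx≡body∷ʳe) = ⊥-elim (x≢e (∷ʳ-injectiveʳ P body P∷ʳx≡body∷ʳe))
  ... | inj₂ r = r

  ∷-≡-∷ʳ : ∀ (x : A) xs → ∃₂ λ ys y → x ∷ xs ≡ ys ∷ʳ y
  ∷-≡-∷ʳ x [] = [] , x , refl
  ∷-≡-∷ʳ x (x′ ∷ xs) with ∷-≡-∷ʳ x′ xs
  ... | ys , y , eq = x ∷ ys , y , cong (x ∷_) eq

  All-reverse : ∀ {P : A → Set} xs → All P xs → All P (reverse xs)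
  All-reverse xs = ↭.All-resp-↭ (↭-sym (↭.↭-reverse xs))

  ∷ʳ-↭⁻ : ∀ {xs ys : List A} x → xs ∷ʳ x ↭ ys ∷ʳ x → xs ↭ ys
  ∷ʳ-↭⁻ {xs} {ys} x p = subst₂ _↭_ (++-identityʳ xs) (++-identityʳ ys) (↭.drop-mid xs ys p)

module _ {A : Set} {R : A → A → Set} where

  Linked-++⁻ˡ : ∀ xs ys → Linked R (xs ++ ys) → Linked R xs
  Linked-++⁻ˡ [] ys l = []
  Linked-++⁻ˡ (x ∷ []) ys l = [-]
  Linked-++⁻ˡ (x ∷ x′ ∷ xs) ys (r ∷ l) = r ∷ Linked-++⁻ˡ (x′ ∷ xs) ys l

  Linked-++⁻ʳ : ∀ xs ys → Linked R (xs ++ ys) → Linked R ys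
  Linked-++⁻ʳ [] ys l = l
  Linked-++⁻ʳ (x ∷ xs) ys l = Linked-++⁻ʳ xs ys (Linked.tail l)

  Linked-glue : ∀ xs y ys → Linked R (xs ∷ʳ y) → Linked R (y ∷ ys) → Linked R (xs ++ y ∷ ys)
  Linked-glue [] y ys _ l = l
  Linked-glue (x ∷ []) y ys (r ∷ _) l = r ∷ l
  Linked-glue (x ∷ x′ ∷ xs) y ys (r ∷ l₁) l = r ∷ Linked-glue (x′ ∷ xs) y ys l₁ l

  Linked-cut : ∀ xs y ys → Linked R (xs ++ y ∷ ys) → Linked R (xs ∷ʳ y) × Linked R (y ∷ ys)
  Linked-cut [] y ys l = [-] , l
  Linked-cut (x ∷ []) y ys (r ∷ l) = r ∷ [-] , l
  Linked-cut (x ∷ x′ ∷ xs) y ys (r ∷ l) =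
    let (l₁ , l₂) = Linked-cut (x′ ∷ xs) y ys l in r ∷ l₁ , l₂

  Linked-replaceLast : ∀ {P : A → Set} xs y y′ → (∀ x → R x y → P x → R x y′) → All P xs →
    Linked R (xs ∷ʳ y) → Linked R (xs ∷ʳ y′)
  Linked-replaceLast [] y y′ f _ _ = [-]
  Linked-replaceLast (x ∷ []) y y′ f (px ∷ _) (r ∷ _) = f x r px ∷ [-]
  Linked-replaceLast (x ∷ x′ ∷ xs) y y′ f (_ ∷ ps) (r ∷ l) =
    r ∷ Linked-replaceLast (x′ ∷ xs) y y′ f ps l

≡ᵇ-refl : ∀ a → (a ≡ᵇ a) ≡ true
≡ᵇ-refl zero = refl
≡ᵇ-refl (suc a) = ≡ᵇ-refl a

≢⇒≡ᵇ-false : ∀ x y → x ≢ y → (x ≡ᵇ y) ≡ false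
≢⇒≡ᵇ-false zero zero ne = ⊥-elim (ne refl)
≢⇒≡ᵇ-false zero (suc y) ne = refl
≢⇒≡ᵇ-false (suc x) zero ne = refl
≢⇒≡ᵇ-false (suc x) (suc y) ne = ≢⇒≡ᵇ-false x y (λ e → ne (cong suc e))

blueElems-++ : ∀ xs ys → blueElems (xs ++ ys) ≡ blueElems xs ++ blueElems ys
blueElems-++ [] ys = refl
blueElems-++ (bbar _ ∷ xs) ys = blueElems-++ xs ys
blueElems-++ (rbar _ ∷ xs) ys = blueElems-++ xs ys
blueElems-++ (pair B _ ∷ xs) ys rewrite blueElems-++ xs ys = sym (++-assoc B _ _)
blueElems-++ (extra B _ ∷ xs) ys rewrite blueElems-++ xs ys = sym (++-assoc B _ _)

redElems-++ : ∀ xs ys → redElems (xs ++ ys) ≡ redElems xs ++ redElems ys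
redElems-++ [] ys = refl
redElems-++ (bbar _ ∷ xs) ys = redElems-++ xs ys
redElems-++ (rbar _ ∷ xs) ys = redElems-++ xs ys
redElems-++ (pair _ R ∷ xs) ys rewrite redElems-++ xs ys = sym (++-assoc R _ _)
redElems-++ (extra _ R ∷ xs) ys rewrite redElems-++ xs ys = sym (++-assoc R _ _)

blueLabels-++ : ∀ xs ys → blueLabels (xs ++ ys) ≡ blueLabels xs ++ blueLabels ys
blueLabels-++ [] ys = refl
blueLabels-++ (bbar i ∷ xs) ys = cong (i ∷_) (blueLabels-++ xs ys)
blueLabels-++ (rbar _ ∷ xs) ys = blueLabels-++ xs ys
blueLabels-++ (pair _ _ ∷ xs) ys = blueLabels-++ xs ys
blueLabels-++ (extra _ _ ∷ xs) ys = blueLabels-++ xs ys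

redLabels-++ : ∀ xs ys → redLabels (xs ++ ys) ≡ redLabels xs ++ redLabels ys
redLabels-++ [] ys = refl
redLabels-++ (bbar _ ∷ xs) ys = redLabels-++ xs ys
redLabels-++ (rbar i ∷ xs) ys = cong (i ∷_) (redLabels-++ xs ys)
redLabels-++ (pair _ _ ∷ xs) ys = redLabels-++ xs ys
redLabels-++ (extra _ _ ∷ xs) ys = redLabels-++ xs ys

blueElems-bars : ∀ ws → All IsBar ws → blueElems ws ≡ []
blueElems-bars [] _ = refl
blueElems-bars (bbar _ ∷ ws) (_ ∷ p) = blueElems-bars ws p
blueElems-bars (rbar _ ∷ ws) (_ ∷ p) = blueElems-bars ws p

redElems-bars : ∀ ws → All IsBar ws → redElems ws ≡ []
redElems-bars [] _ = refl
redElems-bars (bbar _ ∷ ws) (_ ∷ p) = redElems-bars ws p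
redElems-bars (rbar _ ∷ ws) (_ ∷ p) = redElems-bars ws p

∈-redElems-++⁺ʳ : ∀ {x} xs ys → x ∈ redElems ys → x ∈ redElems (xs ++ ys)
∈-redElems-++⁺ʳ xs ys p = subst (_ ∈_) (sym (redElems-++ xs ys)) (∈-++⁺ʳ (redElems xs) p)

∈-redElems-++⁺ˡ : ∀ {x} xs ys → x ∈ redElems xs → x ∈ redElems (xs ++ ys)
∈-redElems-++⁺ˡ xs ys p = subst (_ ∈_) (sym (redElems-++ xs ys)) (∈-++⁺ˡ p)

∈-redLabels-++⁺ˡ : ∀ {x} xs ys → x ∈ redLabels xs → x ∈ redLabels (xs ++ ys)
∈-redLabels-++⁺ˡ xs ys p = subst (_ ∈_) (sym (redLabels-++ xs ys)) (∈-++⁺ˡ p)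

bars⇒noExtra : ∀ {ws} → All IsBar ws → All NotExtra ws
bars⇒noExtra [] = []
bars⇒noExtra {bbar _ ∷ _} (_ ∷ p) = tt ∷ bars⇒noExtra p
bars⇒noExtra {rbar _ ∷ _} (_ ∷ p) = tt ∷ bars⇒noExtra p

bars⇒ItemOK : ∀ {ws} → All IsBar ws → All ItemOK ws
bars⇒ItemOK [] = []
bars⇒ItemOK {bbar _ ∷ _} (_ ∷ p) = tt ∷ bars⇒ItemOK p
bars⇒ItemOK {rbar _ ∷ _} (_ ∷ p) = tt ∷ bars⇒ItemOK p

IsBar⇒isBar : ∀ x → IsBar x → isBar x ≡ true
IsBar⇒isBar (bbar _) _ = refl
IsBar⇒isBar (rbar _) _ = refl

isBar⇒IsBar : ∀ x → isBar x ≡ true → IsBar x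
isBar⇒IsBar (bbar _) _ = tt
isBar⇒IsBar (rbar _) _ = tt

HeadNotBar : Seq → Set
HeadNotBar [] = ⊤
HeadNotBar (x ∷ _) = isBar x ≡ false

HeadNotBar-∷ʳ : ∀ xs e → HeadNotBar xs → isBar e ≡ false → HeadNotBar (xs ∷ʳ e)
HeadNotBar-∷ʳ [] e _ e-nb = e-nb
HeadNotBar-∷ʳ (x ∷ xs) e h _ = h

HeadNotBar-∷ʳ⁻ : ∀ xs e → HeadNotBar (xs ∷ʳ e) → HeadNotBar xs
HeadNotBar-∷ʳ⁻ [] e _ = tt
HeadNotBar-∷ʳ⁻ (x ∷ xs) e h = h

mapExtra-++ : ∀ f xs ys → mapExtra f (xs ++ ys) ≡ mapExtra f xs ++ mapExtra f ys
mapExtra-++ f [] ys = refl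
mapExtra-++ f (bbar i ∷ xs) ys = cong (bbar i ∷_) (mapExtra-++ f xs ys)
mapExtra-++ f (rbar i ∷ xs) ys = cong (rbar i ∷_) (mapExtra-++ f xs ys)
mapExtra-++ f (pair B R ∷ xs) ys = cong (pair B R ∷_) (mapExtra-++ f xs ys)
mapExtra-++ f (extra B R ∷ xs) ys rewrite mapExtra-++ f xs ys = sym (++-assoc (f B R) _ _)

mapExtra-noExtra : ∀ f xs → All NotExtra xs → mapExtra f xs ≡ xs
mapExtra-noExtra f [] _ = refl
mapExtra-noExtra f (bbar i ∷ xs) (_ ∷ p) = cong (bbar i ∷_) (mapExtra-noExtra f xs p)
mapExtra-noExtra f (rbar i ∷ xs) (_ ∷ p) = cong (rbar i ∷_) (mapExtra-noExtra f xs p)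
mapExtra-noExtra f (pair B R ∷ xs) (_ ∷ p) = cong (pair B R ∷_) (mapExtra-noExtra f xs p)

mapExtra-last : ∀ f xs B R → All NotExtra xs → mapExtra f (xs ∷ʳ extra B R) ≡ xs ++ f B R
mapExtra-last f xs B R ne
  rewrite mapExtra-++ f xs (extra B R ∷ []) | mapExtra-noExtra f xs ne = cong (xs ++_) (++-identityʳ (f B R))

setExtraRed-last : ∀ X xs B R → All NotExtra xs →
  setExtraRed X (xs ∷ʳ extra B R) ≡ xs ∷ʳ extra B X
setExtraRed-last X xs B R = mapExtra-last _ xs B R

getExtra-noExtra++ : ∀ xs ys → All NotExtra xs → getExtra (xs ++ ys) ≡ getExtra ys
getExtra-noExtra++ [] ys _ = refl
getExtra-noExtra++ (bbar _ ∷ xs) ys (_ ∷ ne) = getExtra-noExtra++ xs ys ne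
getExtra-noExtra++ (rbar _ ∷ xs) ys (_ ∷ ne) = getExtra-noExtra++ xs ys ne
getExtra-noExtra++ (pair _ _ ∷ xs) ys (_ ∷ ne) = getExtra-noExtra++ xs ys ne

getExtra-last : ∀ xs B R → All NotExtra xs → getExtra (xs ∷ʳ extra B R) ≡ just (B , R)
getExtra-last xs B R ne = getExtra-noExtra++ xs _ ne

takeBars-spec : ∀ xs → let (ws , r) = takeBars xs in
  xs ≡ ws ++ r × All IsBar ws × HeadNotBar r
takeBars-spec [] = refl , [] , tt
takeBars-spec (x ∷ xs) with isBar x in e | takeBars xs | takeBars-spec xs
... | true | (ws , r) | (eq , bars , h) = cong (x ∷_) eq , isBar⇒IsBar x e ∷ bars , h
... | false | _ | _ = refl , [] , e

takeBars-bars++ : ∀ ws r → All IsBar ws → HeadNotBar r → takeBars (ws ++ r) ≡ (ws , r)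
takeBars-bars++ [] [] _ _ = refl
takeBars-bars++ [] (x ∷ r) _ h with isBar x
takeBars-bars++ [] (x ∷ r) _ refl | false = refl
takeBars-bars++ (w ∷ ws) r (pw ∷ pws) h
  with isBar w | IsBar⇒isBar w pw | takeBars (ws ++ r) | takeBars-bars++ ws r pws h
... | true | _ | _ | refl = refl

Adjacent : Item → Item → Set
Adjacent x y = Follows x (y ∷ [])

Follows-head : ∀ x y s s′ → Follows x (y ∷ s) → Follows x (y ∷ s′)
Follows-head (bbar _) (bbar _) s s′ p = p
Follows-head (bbar _) (rbar _) s s′ p = p
Follows-head (rbar _) (bbar _) s s′ p = p
Follows-head (rbar _) (rbar _) s s′ p = p
Follows-head (rbar _) (pair _ _) s s′ p = tt
Follows-head (rbar _) (extra _ _) s s′ p = tt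
Follows-head (pair _ _) y s s′ p = tt
Follows-head (extra _ _) y s s′ p = tt

barsOK⇒linked : ∀ s → BarsOK s → Linked Adjacent s
barsOK⇒linked [] _ = []
barsOK⇒linked (x ∷ []) _ = [-]
barsOK⇒linked (x ∷ y ∷ s) (f , b) = Follows-head x y s [] f ∷ barsOK⇒linked (y ∷ s) b

-- BarsOK also forbids a bar in last position
linked⇒barsOK : ∀ xs e → isBar e ≡ false → Linked Adjacent (xs ∷ʳ e) → BarsOK (xs ∷ʳ e)
linked⇒barsOK [] (pair _ _) _ _ = tt , tt
linked⇒barsOK [] (extra _ _) _ _ = tt , tt
linked⇒barsOK (x ∷ []) e e-nb (r ∷ l) = Follows-head x e [] [] r , linked⇒barsOK [] e e-nb l
linked⇒barsOK (x ∷ y ∷ xs) e e-nb (r ∷ l) =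
  Follows-head x y [] _ r , linked⇒barsOK (y ∷ xs) e e-nb l

BarsOK-++⁻ʳ : ∀ xs ys → BarsOK (xs ++ ys) → BarsOK ys
BarsOK-++⁻ʳ [] ys b = b
BarsOK-++⁻ʳ (x ∷ xs) ys (_ , b) = BarsOK-++⁻ʳ xs ys b

bars-¬BarsOK : ∀ w ws → All IsBar (w ∷ ws) → ¬ BarsOK (w ∷ ws)
bars-¬BarsOK (bbar _) [] _ (() , _)
bars-¬BarsOK (rbar _) [] _ (() , _)
bars-¬BarsOK w (w′ ∷ ws) (_ ∷ p) (_ , b) = bars-¬BarsOK w′ ws p b

nonBar-Adjacent : ∀ x y → isBar x ≡ false → Adjacent x y
nonBar-Adjacent (pair _ _) y _ = tt
nonBar-Adjacent (extra _ _) y _ = tt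

redBar-Adjacent-nonBar : ∀ i z → isBar z ≡ false → Adjacent (rbar i) z
redBar-Adjacent-nonBar i (pair _ _) _ = tt
redBar-Adjacent-nonBar i (extra _ _) _ = tt

Adjacent-nonBar : ∀ x z z′ → isBar z ≡ false → isBar z′ ≡ false → Adjacent x z → Adjacent x z′
Adjacent-nonBar (rbar i) z z′ _ z′-nb _ = redBar-Adjacent-nonBar i z′ z′-nb
Adjacent-nonBar (pair _ _) z z′ _ _ _ = tt
Adjacent-nonBar (extra _ _) z z′ _ _ _ = tt
Adjacent-nonBar (bbar _) (pair _ _) z′ _ _ ()
Adjacent-nonBar (bbar _) (extra _ _) z′ _ _ ()

blueBar-¬Adjacent-nonBar : ∀ i z → isBar z ≡ false → ¬ Adjacent (bbar i) z
blueBar-¬Adjacent-nonBar i (pair _ _) _ ()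
blueBar-¬Adjacent-nonBar i (extra _ _) _ ()

Linked-∷-nonBar : ∀ x s → isBar x ≡ false → Linked Adjacent s → Linked Adjacent (x ∷ s)
Linked-∷-nonBar x [] _ _ = [-]
Linked-∷-nonBar x (y ∷ s) x-nb l = nonBar-Adjacent x y x-nb ∷ l

LastNotBar : Seq → Set
LastNotBar [] = ⊤
LastNotBar (x ∷ []) = isBar x ≡ false
LastNotBar (x ∷ y ∷ s) = LastNotBar (y ∷ s)

LastNotBar-∷ʳ : ∀ xs x → isBar x ≡ false → LastNotBar (xs ∷ʳ x)
LastNotBar-∷ʳ [] x e = e
LastNotBar-∷ʳ (y ∷ []) x e = e
LastNotBar-∷ʳ (y ∷ y′ ∷ ys) x e = LastNotBar-∷ʳ (y′ ∷ ys) x e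

HeadNotBar-reverse : ∀ xs → HeadNotBar (reverse xs) → LastNotBar xs
HeadNotBar-reverse xs h = subst LastNotBar (reverse-involutive xs) (lemma (reverse xs) h)
  where
  lemma : ∀ r → HeadNotBar r → LastNotBar (reverse r)
  lemma [] _ = tt
  lemma (x ∷ r) h rewrite unfold-reverse x r = LastNotBar-∷ʳ (reverse r) x h

Linked-++-lastNotBar : ∀ xs ys → Linked Adjacent xs → LastNotBar xs →
  Linked Adjacent ys → Linked Adjacent (xs ++ ys)
Linked-++-lastNotBar [] ys _ _ l = l
Linked-++-lastNotBar (x ∷ []) [] _ _ _ = [-]
Linked-++-lastNotBar (x ∷ []) (y ∷ ys) _ x-nb l = nonBar-Adjacent x y x-nb ∷ l
Linked-++-lastNotBar (x ∷ x′ ∷ xs) ys (r ∷ l₁) e l = r ∷ Linked-++-lastNotBar (x′ ∷ xs) ys l₁ e l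

head∷ʳ : Seq → Item → Item
head∷ʳ [] e = e
head∷ʳ (d ∷ _) _ = d

head∷ʳ-eq : ∀ D e → D ∷ʳ e ≡ head∷ʳ D e ∷ drop 1 (D ∷ʳ e)
head∷ʳ-eq [] e = refl
head∷ʳ-eq (d ∷ D) e = refl

head∷ʳ-nonBar : ∀ D e → HeadNotBar D → isBar e ≡ false → isBar (head∷ʳ D e) ≡ false
head∷ʳ-nonBar [] e _ e-nb = e-nb
head∷ʳ-nonBar (d ∷ D) e h _ = h

setExtraRedItem : List ℕ → Item → Item
setExtraRedItem X (extra B _) = extra B X
setExtraRedItem X x = x

setExtraRed-map : ∀ X s → setExtraRed X s ≡ map (setExtraRedItem X) s
setExtraRed-map X [] = refl
setExtraRed-map X (bbar i ∷ s) = cong (bbar i ∷_) (setExtraRed-map X s)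
setExtraRed-map X (rbar i ∷ s) = cong (rbar i ∷_) (setExtraRed-map X s)
setExtraRed-map X (pair B R ∷ s) = cong (pair B R ∷_) (setExtraRed-map X s)
setExtraRed-map X (extra B R ∷ s) = cong (extra B X ∷_) (setExtraRed-map X s)

Adjacent-setExtraRed : ∀ X {x y} → Adjacent x y →
  Adjacent (setExtraRedItem X x) (setExtraRedItem X y)
Adjacent-setExtraRed X {bbar _} {bbar _} p = p
Adjacent-setExtraRed X {bbar _} {rbar _} p = p
Adjacent-setExtraRed X {rbar _} {bbar _} p = p
Adjacent-setExtraRed X {rbar _} {rbar _} p = p
Adjacent-setExtraRed X {rbar _} {pair _ _} p = tt
Adjacent-setExtraRed X {rbar _} {extra _ _} p = tt
Adjacent-setExtraRed X {pair _ _} p = tt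
Adjacent-setExtraRed X {extra _ _} p = tt

Linked-setExtraRed : ∀ X s → Linked Adjacent s → Linked Adjacent (setExtraRed X s)
Linked-setExtraRed X s l rewrite setExtraRed-map X s =
  Linked.map⁺ (Linked.map (Adjacent-setExtraRed X) l)

Linked-setExtraRed-last : ∀ X D B R → All NotExtra D →
  Linked Adjacent (D ∷ʳ extra B R) → Linked Adjacent (D ∷ʳ extra B X)
Linked-setExtraRed-last X D B R ne l =
  subst (Linked Adjacent) (setExtraRed-last X D B R ne) (Linked-setExtraRed X _ l)

elemᵇ-false : ∀ a L → a ∉ L → elemᵇ a L ≡ false
elemᵇ-false a [] _ = refl
elemᵇ-false a (y ∷ L) a∉ rewrite ≢⇒≡ᵇ-false y a (λ e → a∉ (here (sym e))) =
  elemᵇ-false a L (λ p → a∉ (there p))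

elemᵇ-head : ∀ a L → elemᵇ a (a ∷ L) ≡ true
elemᵇ-head a L rewrite ≡ᵇ-refl a = refl

removeᵇ-head : ∀ a L → a ∉ L → removeᵇ a (a ∷ L) ≡ L
removeᵇ-head a L a∉ rewrite ≡ᵇ-refl a = removeᵇ-∉ L a∉
  where
  removeᵇ-∉ : ∀ L → a ∉ L → removeᵇ a L ≡ L
  removeᵇ-∉ [] _ = refl
  removeᵇ-∉ (y ∷ L) a∉ rewrite ≢⇒≡ᵇ-false y a (λ e → a∉ (here (sym e))) =
    cong (y ∷_) (removeᵇ-∉ L (λ p → a∉ (there p)))

∉-++⁻ʳ : ∀ {a : ℕ} xs {ys} → a ∉ xs ++ ys → a ∉ ys
∉-++⁻ʳ xs a∉ p = a∉ (∈-++⁺ʳ xs p)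

findBluePair-first : ∀ a xs R ys → a ∉ blueElems xs →
  findBluePair a (xs ++ pair (a ∷ []) R ∷ ys) ≡ just (xs , R , ys)
findBluePair-first a [] R ys _ rewrite ≡ᵇ-refl a = refl
findBluePair-first a (bbar _ ∷ xs) R ys a∉ rewrite findBluePair-first a xs R ys a∉ = refl
findBluePair-first a (rbar _ ∷ xs) R ys a∉ rewrite findBluePair-first a xs R ys a∉ = refl
findBluePair-first a (pair [] _ ∷ xs) R ys a∉ rewrite findBluePair-first a xs R ys a∉ = refl
findBluePair-first a (pair (b ∷ []) _ ∷ xs) R ys a∉
  rewrite ≢⇒≡ᵇ-false b a (λ e → a∉ (here (sym e)))
        | findBluePair-first a xs R ys (λ p → a∉ (there p)) = refl
findBluePair-first a (pair B@(_ ∷ _ ∷ _) _ ∷ xs) R ys a∉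
  rewrite findBluePair-first a xs R ys (∉-++⁻ʳ B a∉) = refl
findBluePair-first a (extra B _ ∷ xs) R ys a∉
  rewrite findBluePair-first a xs R ys (∉-++⁻ʳ B a∉) = refl

findRedPair-first : ∀ a xs B R ys → elemᵇ a R ≡ true → a ∉ redElems xs →
  findRedPair a (xs ++ pair B R ∷ ys) ≡ just (xs , B , R , ys)
findRedPair-first a [] B R ys a∈R _ rewrite a∈R = refl
findRedPair-first a (bbar _ ∷ xs) B R ys a∈R a∉ rewrite findRedPair-first a xs B R ys a∈R a∉ = refl
findRedPair-first a (rbar _ ∷ xs) B R ys a∈R a∉ rewrite findRedPair-first a xs B R ys a∈R a∉ = refl
findRedPair-first a (pair _ R′ ∷ xs) B R ys a∈R a∉
  rewrite elemᵇ-false a R′ (λ p → a∉ (∈-++⁺ˡ p))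
        | findRedPair-first a xs B R ys a∈R (∉-++⁻ʳ R′ a∉) = refl
findRedPair-first a (extra _ R′ ∷ xs) B R ys a∈R a∉
  rewrite findRedPair-first a xs B R ys a∈R (∉-++⁻ʳ R′ a∉) = refl

firstRedPair : ∀ a s → All NotExtra s → a ∈ redElems s →
  Σ Seq λ xs → Σ (List ℕ) λ B → Σ (List ℕ) λ R → Σ Seq λ ys →
    s ≡ xs ++ pair B R ∷ ys × a ∈ R × a ∉ redElems xs
firstRedPair a (bbar i ∷ s) (_ ∷ ne) p with firstRedPair a s ne p
... | xs , B , R , ys , e , a∈ , a∉ = bbar i ∷ xs , B , R , ys , cong (bbar i ∷_) e , a∈ , a∉
firstRedPair a (rbar i ∷ s) (_ ∷ ne) p with firstRedPair a s ne p
... | xs , B , R , ys , e , a∈ , a∉ = rbar i ∷ xs , B , R , ys , cong (rbar i ∷_) e , a∈ , a∉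
firstRedPair a (pair B R ∷ s) (_ ∷ ne) p with a ∈? R
... | yes a∈R = [] , B , R , s , refl , a∈R , λ ()
... | no a∉R with ∈-++⁻ R p
...   | inj₁ q = ⊥-elim (a∉R q)
...   | inj₂ q with firstRedPair a s ne q
...     | xs , B′ , R′ , ys , e , a∈ , a∉ =
  pair B R ∷ xs , B′ , R′ , ys , cong (pair B R ∷_) e , a∈ , λ r → [ a∉R , a∉ ]′ (∈-++⁻ R r)

consJust : Item → Maybe (Seq × Seq) → Maybe (Seq × Seq)
consJust x nothing = nothing
consJust x (just (p , q)) = just (x ∷ p , q)

splitB : ℕ → Seq → Maybe (Seq × Seq)
splitB a [] = nothing
splitB a (bbar j ∷ s) = if j ≡ᵇ a then just ([] , s) else consJust (bbar j) (splitB a s)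
splitB a (x ∷ s) = consJust x (splitB a s)

splitR : ℕ → Seq → Maybe (Seq × Seq)
splitR a [] = nothing
splitR a (rbar j ∷ s) = if j ≡ᵇ a then just ([] , s) else consJust (rbar j) (splitR a s)
splitR a (x ∷ s) = consJust x (splitR a s)

splitB-first : ∀ a xs ys → a ∉ blueLabels xs → splitB a (xs ++ bbar a ∷ ys) ≡ just (xs , ys)
splitB-first a [] ys _ rewrite ≡ᵇ-refl a = refl
splitB-first a (bbar i ∷ xs) ys a∉
  rewrite ≢⇒≡ᵇ-false i a (λ e → a∉ (here (sym e))) | splitB-first a xs ys (λ p → a∉ (there p)) = refl
splitB-first a (rbar _ ∷ xs) ys a∉ rewrite splitB-first a xs ys a∉ = refl
splitB-first a (pair _ _ ∷ xs) ys a∉ rewrite splitB-first a xs ys a∉ = refl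
splitB-first a (extra _ _ ∷ xs) ys a∉ rewrite splitB-first a xs ys a∉ = refl

splitR-first : ∀ a xs ys → a ∉ redLabels xs → splitR a (xs ++ rbar a ∷ ys) ≡ just (xs , ys)
splitR-first a [] ys _ rewrite ≡ᵇ-refl a = refl
splitR-first a (bbar _ ∷ xs) ys a∉ rewrite splitR-first a xs ys a∉ = refl
splitR-first a (rbar i ∷ xs) ys a∉
  rewrite ≢⇒≡ᵇ-false i a (λ e → a∉ (here (sym e))) | splitR-first a xs ys (λ p → a∉ (there p)) = refl
splitR-first a (pair _ _ ∷ xs) ys a∉ rewrite splitR-first a xs ys a∉ = refl
splitR-first a (extra _ _ ∷ xs) ys a∉ rewrite splitR-first a xs ys a∉ = refl

firstBlueBar : ∀ a s → a ∈ blueLabels s →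
  Σ Seq λ xs → Σ Seq λ ys → s ≡ xs ++ bbar a ∷ ys × a ∉ blueLabels xs
firstBlueBar a (rbar i ∷ s) p with firstBlueBar a s p
... | xs , ys , e , a∉ = rbar i ∷ xs , ys , cong (rbar i ∷_) e , a∉
firstBlueBar a (pair B R ∷ s) p with firstBlueBar a s p
... | xs , ys , e , a∉ = pair B R ∷ xs , ys , cong (pair B R ∷_) e , a∉
firstBlueBar a (extra B R ∷ s) p with firstBlueBar a s p
... | xs , ys , e , a∉ = extra B R ∷ xs , ys , cong (extra B R ∷_) e , a∉
firstBlueBar a (bbar i ∷ s) p with i ≟ a
... | yes refl = [] , s , refl , λ ()
... | no i≢a with p
...   | here e = ⊥-elim (i≢a (sym e))
...   | there p′ with firstBlueBar a s p′
...     | xs , ys , e , a∉ =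
  bbar i ∷ xs , ys , cong (bbar i ∷_) e , λ { (here q) → i≢a (sym q) ; (there q) → a∉ q }

firstRedBar : ∀ a s → a ∈ redLabels s →
  Σ Seq λ xs → Σ Seq λ ys → s ≡ xs ++ rbar a ∷ ys × a ∉ redLabels xs
firstRedBar a (bbar i ∷ s) p with firstRedBar a s p
... | xs , ys , e , a∉ = bbar i ∷ xs , ys , cong (bbar i ∷_) e , a∉
firstRedBar a (pair B R ∷ s) p with firstRedBar a s p
... | xs , ys , e , a∉ = pair B R ∷ xs , ys , cong (pair B R ∷_) e , a∉
firstRedBar a (extra B R ∷ s) p with firstRedBar a s p
... | xs , ys , e , a∉ = extra B R ∷ xs , ys , cong (extra B R ∷_) e , a∉
firstRedBar a (rbar i ∷ s) p with i ≟ a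
... | yes refl = [] , s , refl , λ ()
... | no i≢a with p
...   | here e = ⊥-elim (i≢a (sym e))
...   | there p′ with firstRedBar a s p′
...     | xs , ys , e , a∉ =
  rbar i ∷ xs , ys , cong (rbar i ∷_) e , λ { (here q) → i≢a (sym q) ; (there q) → a∉ q }

applyUpTo-cong : ∀ {A : Set} (f g : ℕ → A) n → (∀ i → f i ≡ g i) → applyUpTo f n ≡ applyUpTo g n
applyUpTo-cong f g zero _ = refl
applyUpTo-cong f g (suc n) f≗g =
  cong₂ _∷_ (f≗g 0) (applyUpTo-cong (λ i → f (suc i)) (λ i → g (suc i)) n (λ i → f≗g (suc i)))

range-suc : ∀ m k → range m (suc k) ≡ suc m ∷ range (suc m) k
range-suc m k = cong₂ _∷_ (cong suc (+-identityʳ m)) (applyUpTo-cong _ _ k (λ i → cong suc (+-suc m i)))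

range⇒> : ∀ m k {x} → x ∈ range m k → m < x
range⇒> m k p with ∈-applyUpTo⁻ (λ i → suc (m + i)) p
... | i , _ , refl = s≤s (m≤m+n m i)

∈-applyUpTo-suc⇒≤ : ∀ m {i} → i ∈ applyUpTo suc m → i ≤ m
∈-applyUpTo-suc⇒≤ m p with ∈-applyUpTo⁻ suc p
... | _ , j<m , refl = j<m

∈-upTo-suc⇒≤ : ∀ m {i} → i ∈ upTo (suc m) → i ≤ m
∈-upTo-suc⇒≤ m p with ∈-upTo⁻ p
... | s≤s i≤m = i≤m

LabelsAtMost : ℕ → ℕ → Item → Set
LabelsAtMost b r (bbar i) = i ≤ b
LabelsAtMost b r (rbar i) = i ≤ r
LabelsAtMost b r _ = ⊤

labelsAtMost : ∀ b r s → (∀ {i} → i ∈ blueLabels s → i ≤ b) → (∀ {i} → i ∈ redLabels s → i ≤ r) →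
  All (LabelsAtMost b r) s
labelsAtMost b r [] _ _ = []
labelsAtMost b r (bbar i ∷ s) fb fr = fb (here refl) ∷ labelsAtMost b r s (λ p → fb (there p)) fr
labelsAtMost b r (rbar i ∷ s) fb fr = fr (here refl) ∷ labelsAtMost b r s fb (λ p → fr (there p))
labelsAtMost b r (pair _ _ ∷ s) fb fr = tt ∷ labelsAtMost b r s fb fr
labelsAtMost b r (extra _ _ ∷ s) fb fr = tt ∷ labelsAtMost b r s fb fr

labelsAtMost-↭ : ∀ b r s → blueLabels s ↭ applyUpTo suc b → redLabels s ↭ upTo (suc r) →
  All (LabelsAtMost b r) s
labelsAtMost-↭ b r s pb pr = labelsAtMost b r s
  (λ p → ∈-applyUpTo-suc⇒≤ b (↭.∈-resp-↭ pb p)) (λ p → ∈-upTo-suc⇒≤ r (↭.∈-resp-↭ pr p))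

∈-blueLabels⇒≤ : ∀ {b r xs i} → All (LabelsAtMost b r) xs → i ∈ blueLabels xs → i ≤ b
∈-blueLabels⇒≤ {xs = bbar _ ∷ _} (p ∷ _) (here refl) = p
∈-blueLabels⇒≤ {xs = bbar _ ∷ _} (_ ∷ ps) (there q) = ∈-blueLabels⇒≤ ps q
∈-blueLabels⇒≤ {xs = rbar _ ∷ _} (_ ∷ ps) q = ∈-blueLabels⇒≤ ps q
∈-blueLabels⇒≤ {xs = pair _ _ ∷ _} (_ ∷ ps) q = ∈-blueLabels⇒≤ ps q
∈-blueLabels⇒≤ {xs = extra _ _ ∷ _} (_ ∷ ps) q = ∈-blueLabels⇒≤ ps q

∈-redLabels⇒≤ : ∀ {b r xs i} → All (LabelsAtMost b r) xs → i ∈ redLabels xs → i ≤ r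
∈-redLabels⇒≤ {xs = rbar _ ∷ _} (p ∷ _) (here refl) = p
∈-redLabels⇒≤ {xs = rbar _ ∷ _} (_ ∷ ps) (there q) = ∈-redLabels⇒≤ ps q
∈-redLabels⇒≤ {xs = bbar _ ∷ _} (_ ∷ ps) q = ∈-redLabels⇒≤ ps q
∈-redLabels⇒≤ {xs = pair _ _ ∷ _} (_ ∷ ps) q = ∈-redLabels⇒≤ ps q
∈-redLabels⇒≤ {xs = extra _ _ ∷ _} (_ ∷ ps) q = ∈-redLabels⇒≤ ps q

record Valid (bl rl be re : List ℕ) (s : Seq) : Set where
  field
    items-ok : All ItemOK s
    blue-elems : blueElems s ↭ be
    red-elems : redElems s ↭ re
    blue-labels : blueLabels s ↭ bl
    red-labels : redLabels s ↭ rl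
    linked : Linked Adjacent s

ValidBarred : ℕ → ℕ → ℕ → Seq → Set
ValidBarred m k n = Valid (applyUpTo suc m) (upTo (suc m)) (range m k) (range m n)

-- the sequences between ψ_b and ψ_r: blue bars 1..m+1, red bars 0..m,
-- blue elements m+2..m+k, red elements m+1..m+n
ValidMiddle : ℕ → ℕ → ℕ → Seq → Set
ValidMiddle m k n = Valid (applyUpTo suc (suc m)) (upTo (suc m)) (range (suc m) k) (range m (suc n))

record Normal (V : Seq → Set) (s : Seq) : Set where
  field
    body : Seq
    extraBlue extraRed : List ℕ
    eq : s ≡ body ∷ʳ extra extraBlue extraRed
    body-noExtra : All NotExtra body
    valid : V s

IsBarred⇒Normal : ∀ m k n s → IsBarred m k n s → Normal (ValidBarred m k n) s
IsBarred⇒Normal m k n s ((pre , B , R , [] , refl , ne , _) , ok , pbE , prE , pbL , prL , bo) = record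
  { body = pre ; extraBlue = B ; extraRed = R ; eq = refl ; body-noExtra = ne
  ; valid = record { items-ok = ok ; blue-elems = pbE ; red-elems = prE
                   ; blue-labels = pbL ; red-labels = prL ; linked = barsOK⇒linked _ bo } }
IsBarred⇒Normal m k n s ((pre , B , R , w ∷ ws , refl , _ , bars) , _ , _ , _ , _ , _ , bo) =
  ⊥-elim (bars-¬BarsOK w ws bars
    (BarsOK-++⁻ʳ (pre ∷ʳ extra B R) (w ∷ ws) (subst BarsOK (sym (++-assoc pre _ (w ∷ ws))) bo)))

Normal⇒IsBarred : ∀ m k n s → Normal (ValidBarred m k n) s → IsBarred m k n s
Normal⇒IsBarred m k n s nf =
  (body , extraBlue , extraRed , [] , eq , body-noExtra , []) ,
  items-ok , blue-elems , red-elems , blue-labels , red-labels ,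
  subst BarsOK (sym eq) (linked⇒barsOK body _ refl (subst (Linked Adjacent) eq linked))
  where open Normal nf
        open Valid valid

extra-last : ∀ p q body B R e → All NotExtra body → p ++ extra B R ∷ q ≡ body ∷ʳ e → extra B R ≡ e
extra-last [] q [] B R e _ eq = proj₁ (∷-injective eq)
extra-last [] q (b ∷ body) B R e (b-ne ∷ _) eq = ⊥-elim (subst NotExtra (proj₁ (∷-injective (sym eq))) b-ne)
extra-last (x ∷ p) q [] B R e _ eq = ⊥-elim (empty p (proj₂ (∷-injective eq)))
  where
  empty : ∀ p → p ++ extra B R ∷ q ≢ []
  empty [] ()
  empty (_ ∷ _) ()
extra-last (x ∷ p) q (b ∷ body) B R e (_ ∷ ne) eq = extra-last p q body B R e ne (proj₂ (∷-injective eq))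

bars++≡∷ʳ : ∀ ws ys zs e → All IsBar ws → isBar e ≡ false → ws ++ ys ≡ zs ∷ʳ e →
  ∃ λ D → ys ≡ D ∷ʳ e × zs ≡ ws ++ D
bars++≡∷ʳ ws ys zs e bars e-nb eq with ++-≡-∷ʳ ws ys zs e eq
... | inj₂ r = r
... | inj₁ (refl , refl) with All.++⁻ʳ zs bars
... | e-bar ∷ [] with trans (sym (IsBar⇒isBar e e-bar)) e-nb
... | ()

record BarShape (A W₁ W₂ D : Seq) : Set where
  field
    A-noExtra : All NotExtra A
    A-lastNotBar : HeadNotBar (reverse A)
    W₁-bars : All IsBar W₁
    W₂-bars : All IsBar W₂
    D-headNotBar : HeadNotBar D
    D-noExtra : All NotExtra D

BarShape-swap : ∀ {A W₁ W₂ D} → BarShape A W₁ W₂ D → BarShape A W₂ W₁ D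
BarShape-swap sh = record
  { A-noExtra = A-noExtra ; A-lastNotBar = A-lastNotBar ; W₁-bars = W₂-bars ; W₂-bars = W₁-bars
  ; D-headNotBar = D-headNotBar ; D-noExtra = D-noExtra }
  where open BarShape sh

-- Wˡ and Wʳ are the maximal runs of bars next to the hole between P and Q
record BarRuns (P Q : Seq) (B R : List ℕ) : Set where
  field
    A Wˡ Wʳ D : Seq
    shape : BarShape A Wˡ Wʳ D
    P-eq : P ≡ A ++ Wˡ
    Q-eq : Q ≡ Wʳ ++ D ++ extra B R ∷ []

barRuns : ∀ P x Q body B R → All NotExtra body → NotExtra x →
  P ++ x ∷ Q ≡ body ∷ʳ extra B R → BarRuns P Q B R
barRuns P x Q body B R body-ne x-ne eq = record
  { A = reverse Ar ; Wˡ = reverse Wˡr ; Wʳ = Wʳ ; D = D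
  ; shape = record
    { A-noExtra = All.++⁻ˡ (reverse Ar) (All.++⁻ˡ (reverse Ar ++ reverse Wˡr) (All.++⁻ˡ P∷ʳx ne))
    ; A-lastNotBar = subst HeadNotBar (sym (reverse-involutive Ar)) (proj₂ (proj₂ P-runs))
    ; W₁-bars = All-reverse Wˡr (proj₁ (proj₂ P-runs))
    ; W₂-bars = Wʳ-bars
    ; D-headNotBar = HeadNotBar-∷ʳ⁻ D e (subst HeadNotBar rest-eq (proj₂ (proj₂ Q-runs)))
    ; D-noExtra = All.++⁻ʳ Wʳ (All.++⁻ʳ P∷ʳx ne) }
  ; P-eq = P-eq
  ; Q-eq = trans (proj₁ Q-runs) (cong (Wʳ ++_) rest-eq) }
  where
  e = extra B R
  split = ∷-hole-≡-∷ʳ P x Q body e (λ x≡e → subst NotExtra x≡e x-ne) eq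
  Q₀ = proj₁ split
  Wʳ = proj₁ (takeBars Q)
  Q-runs = takeBars-spec Q
  Wʳ-bars = proj₁ (proj₂ Q-runs)
  rest-split = bars++≡∷ʳ Wʳ _ Q₀ e Wʳ-bars refl (trans (sym (proj₁ Q-runs)) (proj₁ (proj₂ split)))
  D = proj₁ rest-split
  rest-eq = proj₁ (proj₂ rest-split)
  Wˡr = proj₁ (takeBars (reverse P))
  Ar = proj₂ (takeBars (reverse P))
  P-runs = takeBars-spec (reverse P)
  P-eq : P ≡ reverse Ar ++ reverse Wˡr
  P-eq = begin
      P                          ≡⟨ sym (reverse-involutive P) ⟩
      reverse (reverse P)        ≡⟨ cong reverse (proj₁ P-runs) ⟩
      reverse (Wˡr ++ Ar)        ≡⟨ reverse-++ Wˡr Ar ⟩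
      reverse Ar ++ reverse Wˡr  ∎
    where open ≡-Reasoning
  P∷ʳx = (reverse Ar ++ reverse Wˡr) ∷ʳ x
  ne : All NotExtra (P∷ʳx ++ Wʳ ++ D)
  ne = subst (All NotExtra)
    (trans (proj₂ (proj₂ split)) (cong₂ (λ u v → (u ∷ʳ x) ++ v) P-eq (proj₂ (proj₂ rest-split)))) body-ne

reassoc-last : ∀ (P : Seq) x W D e → P ++ x ∷ W ++ D ++ e ∷ [] ≡ (P ++ x ∷ W ++ D) ∷ʳ e
reassoc-last P x W D e = trans (cong (λ z → P ++ x ∷ z) (sym (++-assoc W D _))) (sym (++-assoc P _ _))

setExtraRed-hole : ∀ X P x W D B R → All NotExtra (P ++ x ∷ W ++ D) →
  setExtraRed X (P ++ x ∷ W ++ D ++ extra B R ∷ []) ≡ P ++ x ∷ W ++ D ++ extra B X ∷ []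
setExtraRed-hole X P x W D B R ne = begin
  setExtraRed X (P ++ x ∷ W ++ D ++ extra B R ∷ [])  ≡⟨ cong (setExtraRed X) (reassoc-last P x W D _) ⟩
  setExtraRed X ((P ++ x ∷ W ++ D) ∷ʳ extra B R)     ≡⟨ setExtraRed-last X _ B R ne ⟩
  (P ++ x ∷ W ++ D) ∷ʳ extra B X                     ≡⟨ sym (reassoc-last P x W D _) ⟩
  P ++ x ∷ W ++ D ++ extra B X ∷ []                  ∎
  where open ≡-Reasoning

getExtra-hole : ∀ P x W D B R → All NotExtra (P ++ x ∷ W ++ D) →
  getExtra (P ++ x ∷ W ++ D ++ extra B R ∷ []) ≡ just (B , R)
getExtra-hole P x W D B R ne =
  trans (cong getExtra (reassoc-last P x W D _)) (getExtra-last _ B R ne)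

-- The step ψ_b

-- with W₁, W₂ the maximal bar runs left and right of the pair ({m+1}, R), ψ_b turns the first
-- sequence into the second
withPair withBlueBar : ℕ → (A W₁ : Seq) → List ℕ → (W₂ D : Seq) → List ℕ → Seq
withPair m A W₁ R W₂ D B = (A ++ W₁) ++ pair (suc m ∷ []) R ∷ W₂ ++ D ++ extra B [] ∷ []
withBlueBar m A W₁ R W₂ D B = (A ++ W₂) ++ bbar (suc m) ∷ W₁ ++ D ++ extra B R ∷ []

unψb′ : ℕ → Maybe (Seq × Seq) → Maybe (List ℕ × List ℕ) → Seq
unψb′ m (just (P , Q)) (just (_ , R)) =
  setExtraRed [] (reverse (proj₂ (takeBars (reverse P))) ++ proj₁ (takeBars Q) ++
    pair (suc m ∷ []) R ∷ reverse (proj₁ (takeBars (reverse P))) ++ proj₂ (takeBars Q))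
unψb′ m _ _ = []

unψb : ℕ → Seq → Seq
unψb m γ = unψb′ m (splitB (suc m) γ) (getExtra γ)

module _ (m : ℕ) {A W₁ W₂ D : Seq} (sh : BarShape A W₁ W₂ D) (B R : List ℕ) where
  open BarShape sh

  noExtra-withPair : All NotExtra ((A ++ W₁) ++ pair (suc m ∷ []) R ∷ W₂ ++ D)
  noExtra-withPair =
    All.++⁺ (All.++⁺ A-noExtra (bars⇒noExtra W₁-bars)) (tt ∷ All.++⁺ (bars⇒noExtra W₂-bars) D-noExtra)

  noExtra-withBlueBar : All NotExtra ((A ++ W₂) ++ bbar (suc m) ∷ W₁ ++ D)
  noExtra-withBlueBar =
    All.++⁺ (All.++⁺ A-noExtra (bars⇒noExtra W₂-bars)) (tt ∷ All.++⁺ (bars⇒noExtra W₁-bars) D-noExtra)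

  ψb-withPair : suc m ∉ blueElems (A ++ W₁) → ψb m (withPair m A W₁ R W₂ D B) ≡ withBlueBar m A W₁ R W₂ D B
  ψb-withPair m∉
    rewrite findBluePair-first (suc m) (A ++ W₁) R (W₂ ++ D ++ extra B [] ∷ []) m∉
          | reverse-++ A W₁
          | takeBars-bars++ (reverse W₁) (reverse A) (All-reverse W₁ W₁-bars) A-lastNotBar
          | takeBars-bars++ W₂ (D ++ extra B [] ∷ []) W₂-bars (HeadNotBar-∷ʳ D _ D-headNotBar refl)
          | reverse-involutive A | reverse-involutive W₁
          | sym (++-assoc A W₂ (bbar (suc m) ∷ W₁ ++ D ++ extra B [] ∷ []))
    = setExtraRed-hole R (A ++ W₂) (bbar (suc m)) W₁ D B [] noExtra-withBlueBar

  unψb-withBlueBar : suc m ∉ blueLabels (A ++ W₂) →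
    unψb m (withBlueBar m A W₁ R W₂ D B) ≡ withPair m A W₁ R W₂ D B
  unψb-withBlueBar m∉
    rewrite splitB-first (suc m) (A ++ W₂) (W₁ ++ D ++ extra B R ∷ []) m∉
          | getExtra-hole (A ++ W₂) (bbar (suc m)) W₁ D B R noExtra-withBlueBar
          | reverse-++ A W₂
          | takeBars-bars++ (reverse W₂) (reverse A) (All-reverse W₂ W₂-bars) A-lastNotBar
          | takeBars-bars++ W₁ (D ++ extra B R ∷ []) W₁-bars (HeadNotBar-∷ʳ D _ D-headNotBar refl)
          | reverse-involutive A | reverse-involutive W₂
          | sym (++-assoc A W₁ (pair (suc m ∷ []) R ∷ W₂ ++ D ++ extra B R ∷ []))
    = setExtraRed-hole [] (A ++ W₁) (pair (suc m ∷ []) R) W₂ D B R noExtra-withPair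

Adjacent-nonBar⇒blueBar : ∀ {b r} j x z → isBar z ≡ false → Adjacent x z → LabelsAtMost b r x → r < j →
  Adjacent x (bbar j)
Adjacent-nonBar⇒blueBar j (bbar i) z z-nb adj _ _ = ⊥-elim (blueBar-¬Adjacent-nonBar i z z-nb adj)
Adjacent-nonBar⇒blueBar j (rbar i) z _ _ i≤r r<j = ≤-<-trans i≤r r<j
Adjacent-nonBar⇒blueBar j (pair _ _) z _ _ _ _ = tt
Adjacent-nonBar⇒blueBar j (extra _ _) z _ _ _ _ = tt

Adjacent-nonBar⇒redBar : ∀ {b r} j x z → isBar z ≡ false → Adjacent x z → LabelsAtMost b r x → r < j →
  Adjacent x (rbar j)
Adjacent-nonBar⇒redBar j (bbar i) z z-nb adj _ _ = ⊥-elim (blueBar-¬Adjacent-nonBar i z z-nb adj)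
Adjacent-nonBar⇒redBar j (rbar i) z _ _ i≤r r<j = ≤-<-trans i≤r r<j
Adjacent-nonBar⇒redBar j (pair _ _) z _ _ _ _ = tt
Adjacent-nonBar⇒redBar j (extra _ _) z _ _ _ _ = tt

-- a blue bar only precedes smaller labels, so nothing labelled ≤ b precedes a bar labelled b
Adjacent-blueBar⇒nonBar : ∀ {r} b x z → isBar z ≡ false → Adjacent x (bbar b) → LabelsAtMost b r x →
  Adjacent x z
Adjacent-blueBar⇒nonBar b (bbar i) z _ b<i i≤b = ⊥-elim (<-irrefl refl (<-≤-trans b<i i≤b))
Adjacent-blueBar⇒nonBar b (rbar i) z z-nb _ _ = redBar-Adjacent-nonBar i z z-nb
Adjacent-blueBar⇒nonBar b (pair _ _) z _ _ _ = tt
Adjacent-blueBar⇒nonBar b (extra _ _) z _ _ _ = tt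

Adjacent-redBar⇒nonBar : ∀ {r} b x z → isBar z ≡ false → Adjacent x (rbar b) → LabelsAtMost b r x →
  Adjacent x z
Adjacent-redBar⇒nonBar b (bbar i) z _ b<i i≤b = ⊥-elim (<-irrefl refl (<-≤-trans b<i i≤b))
Adjacent-redBar⇒nonBar b (rbar i) z z-nb _ _ = redBar-Adjacent-nonBar i z z-nb
Adjacent-redBar⇒nonBar b (pair _ _) z _ _ _ = tt
Adjacent-redBar⇒nonBar b (extra _ _) z _ _ _ = tt

blueBar-Adjacent-bar : ∀ {b r} j w → IsBar w → LabelsAtMost b r w → b < j → r < j → Adjacent (bbar j) w
blueBar-Adjacent-bar j (bbar i) _ i≤b b<j _ = ≤-<-trans i≤b b<j
blueBar-Adjacent-bar j (rbar i) _ i≤r _ r<j = ≤-<-trans i≤r r<j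

module _ (m : ℕ) {A W₁ W₂ D : Seq} (sh : BarShape A W₁ W₂ D) (B R : List ℕ) where
  open BarShape sh
  private
    α = withPair m A W₁ R W₂ D B
    γ = withBlueBar m A W₁ R W₂ D B

  blueElems-ψb : blueElems α ↭ suc m ∷ blueElems γ
  blueElems-ψb
    rewrite blueElems-++ (A ++ W₁) (pair (suc m ∷ []) R ∷ W₂ ++ D ++ extra B [] ∷ [])
          | blueElems-++ A W₁ | blueElems-++ W₂ (D ++ extra B [] ∷ [])
          | blueElems-++ (A ++ W₂) (bbar (suc m) ∷ W₁ ++ D ++ extra B R ∷ [])
          | blueElems-++ A W₂ | blueElems-++ W₁ (D ++ extra B R ∷ [])
          | blueElems-++ D (extra B [] ∷ []) | blueElems-++ D (extra B R ∷ [])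
          | blueElems-bars W₁ W₁-bars | blueElems-bars W₂ W₂-bars | ++-identityʳ (blueElems A)
    = ↭.shift (suc m) (blueElems A) _

  redElems-ψb : redElems γ ↭ redElems α
  redElems-ψb
    rewrite redElems-++ (A ++ W₁) (pair (suc m ∷ []) R ∷ W₂ ++ D ++ extra B [] ∷ [])
          | redElems-++ A W₁ | redElems-++ W₂ (D ++ extra B [] ∷ [])
          | redElems-++ (A ++ W₂) (bbar (suc m) ∷ W₁ ++ D ++ extra B R ∷ [])
          | redElems-++ A W₂ | redElems-++ W₁ (D ++ extra B R ∷ [])
          | redElems-++ D (extra B [] ∷ []) | redElems-++ D (extra B R ∷ [])
          | redElems-bars W₁ W₁-bars | redElems-bars W₂ W₂-bars | ++-identityʳ (redElems A)
    = prove 4 (a ⊕ (d ⊕ (r ⊕ e))) (a ⊕ (r ⊕ (d ⊕ e))) (redElems A ∷ redElems D ∷ R ∷ [] ∷ [])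
    where a = var zero ; d = var (suc zero) ; r = var (suc (suc zero)) ; e = var (suc (suc (suc zero)))

  blueLabels-ψb : blueLabels γ ↭ blueLabels α ∷ʳ suc m
  blueLabels-ψb
    rewrite blueLabels-++ (A ++ W₁) (pair (suc m ∷ []) R ∷ W₂ ++ D ++ extra B [] ∷ [])
          | blueLabels-++ A W₁ | blueLabels-++ W₂ (D ++ extra B [] ∷ [])
          | blueLabels-++ (A ++ W₂) (bbar (suc m) ∷ W₁ ++ D ++ extra B R ∷ [])
          | blueLabels-++ A W₂ | blueLabels-++ W₁ (D ++ extra B R ∷ [])
          | blueLabels-++ D (extra B [] ∷ []) | blueLabels-++ D (extra B R ∷ [])
    = prove 5 ((a ⊕ w₂) ⊕ (x ⊕ (w₁ ⊕ d))) (((a ⊕ w₁) ⊕ (w₂ ⊕ d)) ⊕ x)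
        (blueLabels A ∷ blueLabels W₁ ∷ blueLabels W₂ ∷ (blueLabels D ++ []) ∷ (suc m ∷ []) ∷ [])
    where a = var zero ; w₁ = var (suc zero) ; w₂ = var (suc (suc zero))
          d = var (suc (suc (suc zero))) ; x = var (suc (suc (suc (suc zero))))

  redLabels-ψb : redLabels γ ↭ redLabels α
  redLabels-ψb
    rewrite redLabels-++ (A ++ W₁) (pair (suc m ∷ []) R ∷ W₂ ++ D ++ extra B [] ∷ [])
          | redLabels-++ A W₁ | redLabels-++ W₂ (D ++ extra B [] ∷ [])
          | redLabels-++ (A ++ W₂) (bbar (suc m) ∷ W₁ ++ D ++ extra B R ∷ [])
          | redLabels-++ A W₂ | redLabels-++ W₁ (D ++ extra B R ∷ [])
          | redLabels-++ D (extra B [] ∷ []) | redLabels-++ D (extra B R ∷ [])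
    = prove 4 ((a ⊕ w₂) ⊕ (w₁ ⊕ d)) ((a ⊕ w₁) ⊕ (w₂ ⊕ d))
        (redLabels A ∷ redLabels W₁ ∷ redLabels W₂ ∷ (redLabels D ++ []) ∷ [])
    where a = var zero ; w₁ = var (suc zero) ; w₂ = var (suc (suc zero)) ; d = var (suc (suc (suc zero)))

  private
    p = pair (suc m ∷ []) R
    bb = bbar (suc m)
    T = D ++ extra B [] ∷ []
    T′ = D ++ extra B R ∷ []
    A-lastNotBar′ = HeadNotBar-reverse A A-lastNotBar

  itemsOK-withBlueBar : All ItemOK α → All ItemOK γ × R ≢ []
  itemsOK-withBlueBar ok =
    All.++⁺ (All.++⁺ okA (bars⇒ItemOK W₂-bars))
            (tt ∷ All.++⁺ (bars⇒ItemOK W₁-bars) (All.++⁺ okD ((B-sorted , R-sorted) ∷ []))) ,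
    R≢[]
    where
    okA = All.++⁻ˡ A (All.++⁻ˡ (A ++ W₁) ok)
    ok-rest = All.++⁻ʳ (A ++ W₁) ok
    okT = All.++⁻ʳ W₂ (All.tail ok-rest)
    okD = All.++⁻ˡ D okT
    B-sorted = proj₁ (All.head (All.++⁻ʳ D okT))
    R≢[] = proj₁ (proj₂ (All.head ok-rest))
    R-sorted = proj₂ (proj₂ (proj₂ (All.head ok-rest)))

  itemsOK-withPair : R ≢ [] → All ItemOK γ → All ItemOK α
  itemsOK-withPair R≢[] ok =
    All.++⁺ (All.++⁺ okA (bars⇒ItemOK W₁-bars))
            (((λ ()) , R≢[] , [-] , R-sorted) ∷
              All.++⁺ (bars⇒ItemOK W₂-bars) (All.++⁺ okD ((B-sorted , []) ∷ [])))
    where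
    okA = All.++⁻ˡ A (All.++⁻ˡ (A ++ W₂) ok)
    okT = All.++⁻ʳ W₁ (All.tail (All.++⁻ʳ (A ++ W₂) ok))
    okD = All.++⁻ˡ D okT
    B-sorted = proj₁ (All.head (All.++⁻ʳ D okT))
    R-sorted = proj₂ (All.head (All.++⁻ʳ D okT))

  -- both directions split the sequence at the moved item and re-glue the bar runs W₁, W₂ on
  -- the other side; the label bounds make the bar conditions at the seams hold
  linked-withBlueBar : W₁ ≢ [] → All (LabelsAtMost m m) α → Linked Adjacent α → Linked Adjacent γ
  linked-withBlueBar W₁≢[] labels l =
    Linked-glue (A ++ W₂) bb (W₁ ++ T′) LAW₂bb (bb-W₁T′ W₁ W₁≢[] W₁-bars labW₁ LW₁T′)
    where
    labW₁ = All.++⁻ʳ A (All.++⁻ˡ (A ++ W₁) labels)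
    labW₂ = All.++⁻ˡ W₂ (All.tail (All.++⁻ʳ (A ++ W₁) labels))
    cut = Linked-cut (A ++ W₁) p (W₂ ++ T) l
    LAW₁p = subst (Linked Adjacent) (++-assoc A W₁ (p ∷ [])) (proj₁ cut)
    LA = Linked-++⁻ˡ A _ LAW₁p
    LW₁p = Linked-++⁻ʳ A _ LAW₁p
    LW₂T = Linked.tail (proj₂ cut)
    t = head∷ʳ D (extra B [])
    t-nb = head∷ʳ-nonBar D _ D-headNotBar refl
    t′ = head∷ʳ D (extra B R)
    t′-nb = head∷ʳ-nonBar D _ D-headNotBar refl
    LT′ = subst (Linked Adjacent) (head∷ʳ-eq D _)
      (Linked-setExtraRed-last R D B [] D-noExtra (Linked-++⁻ʳ W₂ T LW₂T))
    LW₂bb : Linked Adjacent (W₂ ∷ʳ bb)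
    LW₂bb = Linked-replaceLast W₂ t bb (λ x adj lab → Adjacent-nonBar⇒blueBar (suc m) x t t-nb adj lab (n<1+n m))
      labW₂ (proj₁ (Linked-cut W₂ t _ (subst (λ z → Linked Adjacent (W₂ ++ z)) (head∷ʳ-eq D _) LW₂T)))
    LAW₂bb = subst (Linked Adjacent) (sym (++-assoc A W₂ (bb ∷ [])))
      (Linked-++-lastNotBar A (W₂ ∷ʳ bb) LA A-lastNotBar′ LW₂bb)
    LW₁T′ : Linked Adjacent (W₁ ++ T′)
    LW₁T′ = subst (λ z → Linked Adjacent (W₁ ++ z)) (sym (head∷ʳ-eq D _))
      (Linked-glue W₁ t′ _ (Linked-replaceLast W₁ p t′ (λ x adj _ → Adjacent-nonBar x p t′ refl t′-nb adj)
        W₁-bars LW₁p) LT′)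
    bb-W₁T′ : ∀ W → W ≢ [] → All IsBar W → All (LabelsAtMost m m) W →
      Linked Adjacent (W ++ T′) → Linked Adjacent (bb ∷ W ++ T′)
    bb-W₁T′ [] W≢[] _ _ _ = ⊥-elim (W≢[] refl)
    bb-W₁T′ (w ∷ _) _ (w-bar ∷ _) (w-lab ∷ _) l′ =
      blueBar-Adjacent-bar (suc m) w w-bar w-lab (n<1+n m) (n<1+n m) ∷ l′

  linked-withPair : All (LabelsAtMost (suc m) m) γ → Linked Adjacent γ → Linked Adjacent α
  linked-withPair labels l =
    Linked-glue (A ++ W₁) p (W₂ ++ T) LAW₁p (Linked-∷-nonBar p _ refl LW₂T)
    where
    labW₂ = All.++⁻ʳ A (All.++⁻ˡ (A ++ W₂) labels)
    cut = Linked-cut (A ++ W₂) bb (W₁ ++ T′) l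
    LAW₂bb = subst (Linked Adjacent) (++-assoc A W₂ (bb ∷ [])) (proj₁ cut)
    LA = Linked-++⁻ˡ A _ LAW₂bb
    LW₂bb = Linked-++⁻ʳ A _ LAW₂bb
    LW₁T′ = Linked.tail (proj₂ cut)
    t = head∷ʳ D (extra B [])
    t-nb = head∷ʳ-nonBar D _ D-headNotBar refl
    t′ = head∷ʳ D (extra B R)
    t′-nb = head∷ʳ-nonBar D _ D-headNotBar refl
    LT = subst (Linked Adjacent) (head∷ʳ-eq D _)
      (Linked-setExtraRed-last [] D B R D-noExtra (Linked-++⁻ʳ W₁ T′ LW₁T′))
    LW₁p : Linked Adjacent (W₁ ∷ʳ p)
    LW₁p = Linked-replaceLast W₁ t′ p (λ x adj _ → Adjacent-nonBar x t′ p t′-nb refl adj) W₁-bars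
      (proj₁ (Linked-cut W₁ t′ _ (subst (λ z → Linked Adjacent (W₁ ++ z)) (head∷ʳ-eq D _) LW₁T′)))
    LAW₁p = subst (Linked Adjacent) (sym (++-assoc A W₁ (p ∷ [])))
      (Linked-++-lastNotBar A (W₁ ∷ʳ p) LA A-lastNotBar′ LW₁p)
    LW₂T : Linked Adjacent (W₂ ++ T)
    LW₂T = subst (λ z → Linked Adjacent (W₂ ++ z)) (sym (head∷ʳ-eq D _))
      (Linked-glue W₂ t _ (Linked-replaceLast W₂ bb t
        (λ x adj lab → Adjacent-blueBar⇒nonBar (suc m) x t t-nb adj lab)
        labW₂ LW₂bb) LT)

  valid-withBlueBar : ∀ k n → W₁ ≢ [] → ValidBarred m (suc k) (suc n) α → ValidMiddle m k n γ × R ≢ []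
  valid-withBlueBar k n W₁≢[] v = record
    { items-ok = proj₁ items
    ; blue-elems = ↭.drop-∷ (↭-trans (↭-sym blueElems-ψb) (subst (blueElems α ↭_) (range-suc m k) blue-elems))
    ; red-elems = ↭-trans redElems-ψb red-elems
    ; blue-labels = subst (blueLabels γ ↭_) (applyUpTo-∷ʳ suc m)
        (↭-trans blueLabels-ψb (↭.++⁺ʳ (suc m ∷ []) blue-labels))
    ; red-labels = ↭-trans redLabels-ψb red-labels
    ; linked = linked-withBlueBar W₁≢[] (labelsAtMost-↭ m m α blue-labels red-labels) linked
    } , proj₂ items
    where
    open Valid v
    items = itemsOK-withBlueBar items-ok

  valid-withPair : ∀ k n → R ≢ [] → ValidMiddle m k n γ → ValidBarred m (suc k) (suc n) α
  valid-withPair k n R≢[] v = record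
    { items-ok = itemsOK-withPair R≢[] items-ok
    ; blue-elems = subst (blueElems α ↭_) (sym (range-suc m k)) (↭-trans blueElems-ψb (prep (suc m) blue-elems))
    ; red-elems = ↭-trans (↭-sym redElems-ψb) red-elems
    ; blue-labels = ∷ʳ-↭⁻ (suc m) (↭-trans (↭-sym blueLabels-ψb)
        (subst (blueLabels γ ↭_) (sym (applyUpTo-∷ʳ suc m)) blue-labels))
    ; red-labels = ↭-trans (↭-sym redLabels-ψb) red-labels
    ; linked = linked-withPair (labelsAtMost-↭ (suc m) m γ blue-labels red-labels) linked
    }
    where open Valid v

  normal-withBlueBar : ∀ {V} → V γ → Normal V γ
  normal-withBlueBar v = record
    { body = (A ++ W₂) ++ bb ∷ W₁ ++ D ; extraBlue = B ; extraRed = R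
    ; eq = reassoc-last (A ++ W₂) bb W₁ D _ ; body-noExtra = noExtra-withBlueBar m sh B R ; valid = v }

  inDomain-withPair : ∀ k n → W₁ ≢ [] → ValidBarred m k n α → InDomain m k n α
  inDomain-withPair k n W₁≢[] v =
    Normal⇒IsBarred m k n α (record
      { body = (A ++ W₁) ++ p ∷ W₂ ++ D ; extraBlue = B ; extraRed = []
      ; eq = reassoc-last (A ++ W₁) p W₂ D _ ; body-noExtra = noExtra-withPair m sh B R ; valid = v }) ,
    (_ , B , [] , reassoc-last (A ++ W₁) p W₂ D _) ,
    barBeforePair W₁ W₁≢[] W₁-bars
    where
    barBeforePair : ∀ W → W ≢ [] → All IsBar W →
      Σ Seq λ pre → Σ Item λ b → Σ (List ℕ) λ R′ → Σ Seq λ post →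
        IsBar b × ((A ++ W) ++ p ∷ W₂ ++ T ≡ pre ++ b ∷ pair (suc m ∷ []) R′ ∷ post)
    barBeforePair [] W≢[] _ = ⊥-elim (W≢[] refl)
    barBeforePair (w ∷ W) _ bars with ∷-≡-∷ʳ w W
    ... | I , b , w∷W≡I∷ʳb = A ++ I , b , R , W₂ ++ T ,
      All.head (All.++⁻ʳ I (subst (All IsBar) w∷W≡I∷ʳb bars)) ,
      (begin
        (A ++ w ∷ W) ++ p ∷ W₂ ++ T       ≡⟨ cong (λ z → (A ++ z) ++ p ∷ W₂ ++ T) w∷W≡I∷ʳb ⟩
        (A ++ I ∷ʳ b) ++ p ∷ W₂ ++ T      ≡⟨ cong (_++ p ∷ W₂ ++ T) (sym (++-assoc A I (b ∷ []))) ⟩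
        ((A ++ I) ∷ʳ b) ++ p ∷ W₂ ++ T    ≡⟨ ++-assoc (A ++ I) (b ∷ []) _ ⟩
        (A ++ I) ++ b ∷ p ∷ W₂ ++ T       ∎)
      where open ≡-Reasoning

  m+1∉blueElems : ∀ k → blueElems γ ↭ range (suc m) k → suc m ∉ blueElems (A ++ W₁)
  m+1∉blueElems k γ-elems m+1∈ = <-irrefl refl (range⇒> (suc m) k (↭.∈-resp-↭ γ-elems m+1∈γ))
    where
    m+1∈A : suc m ∈ blueElems A
    m+1∈A with ∈-++⁻ (blueElems A) (subst (suc m ∈_) (blueElems-++ A W₁) m+1∈)
    ... | inj₁ q = q
    ... | inj₂ q with subst (suc m ∈_) (blueElems-bars W₁ W₁-bars) q
    ... | ()
    m+1∈γ : suc m ∈ blueElems γ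
    m+1∈γ = subst (suc m ∈_) (sym (blueElems-++ (A ++ W₂) _))
      (∈-++⁺ˡ (subst (suc m ∈_) (sym (blueElems-++ A W₂)) (∈-++⁺ˡ m+1∈A)))

  m+1∉blueLabels : All (LabelsAtMost m m) α → suc m ∉ blueLabels (A ++ W₂)
  m+1∉blueLabels labels m+1∈ = <-irrefl refl (∈-blueLabels⇒≤ labA++W₂ m+1∈)
    where
    labA++W₂ = All.++⁺ (All.++⁻ˡ A (All.++⁻ˡ (A ++ W₁) labels))
                       (All.++⁻ˡ W₂ (All.tail (All.++⁻ʳ (A ++ W₁) labels)))

record Middle (m k n : ℕ) (γ : Seq) : Set where
  field
    normal : Normal (ValidMiddle m k n) γ
    extraRed≢[] : Normal.extraRed normal ≢ []

record PairShape (m : ℕ) (α : Seq) : Set where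
  field
    A W₁ W₂ D : Seq
    B R : List ℕ
    shape : BarShape A W₁ W₂ D
    W₁≢[] : W₁ ≢ []
    α-eq : α ≡ withPair m A W₁ R W₂ D B

record BlueBarShape (m : ℕ) (γ : Seq) : Set where
  field
    A W₁ W₂ D : Seq
    B R : List ℕ
    shape : BarShape A W₁ W₂ D
    R≢[] : R ≢ []
    m+1∉ : suc m ∉ blueLabels (A ++ W₂)
    γ-eq : γ ≡ withBlueBar m A W₁ R W₂ D B

pairShape : ∀ m k n α → InDomain m k n α → PairShape m α
pairShape m k n α (barred , (pre′ , B′ , post′ , α≡′) , (pre , b , R , post , b-bar , α≡)) = record
  { A = A ; W₁ = Wˡ ; W₂ = Wʳ ; D = D ; B = extraBlue ; R = R ; shape = shape
  ; W₁≢[] = Wˡ≢[]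
  ; α-eq = begin
      α                                                 ≡⟨ α≡ ⟩
      pre ++ b ∷ p ∷ post                               ≡⟨ sym (++-assoc pre (b ∷ []) _) ⟩
      (pre ∷ʳ b) ++ p ∷ post                            ≡⟨ cong₂ (λ u v → u ++ p ∷ v) P-eq Q-eq ⟩
      (A ++ Wˡ) ++ p ∷ Wʳ ++ D ++ extra extraBlue extraRed ∷ []
        ≡⟨ cong (λ r → (A ++ Wˡ) ++ p ∷ Wʳ ++ D ++ extra extraBlue r ∷ []) extraRed≡[] ⟩
      withPair m A Wˡ R Wʳ D extraBlue                  ∎ }
  where
  open ≡-Reasoning
  open Normal (IsBarred⇒Normal m k n α barred)
  p = pair (suc m ∷ []) R
  runs = barRuns (pre ∷ʳ b) p post body extraBlue extraRed body-noExtra tt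
    (trans (++-assoc pre (b ∷ []) _) (trans (sym α≡) eq))
  open BarRuns runs
  extraRed≡[] : extraRed ≡ []
  extraRed≡[] = cong extraRedOf (sym (extra-last pre′ post′ body B′ [] _ body-noExtra (trans (sym α≡′) eq)))
    where
    extraRedOf : Item → List ℕ
    extraRedOf (extra _ R) = R
    extraRedOf _ = []
  Wˡ≢[] : Wˡ ≢ []
  Wˡ≢[] Wˡ≡[] with trans (sym (IsBar⇒isBar b b-bar)) (subst HeadNotBar rev-A (BarShape.A-lastNotBar shape))
    where
    rev-A : reverse A ≡ b ∷ reverse pre
    rev-A = trans (cong reverse (sym (trans P-eq (trans (cong (A ++_) Wˡ≡[]) (++-identityʳ A)))))
                  (reverse-++ pre (b ∷ []))
  ... | ()

blueBarShape : ∀ m k n γ → Middle m k n γ → BlueBarShape m γ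
blueBarShape m k n γ mid = record
  { A = A ; W₁ = Wʳ ; W₂ = Wˡ ; D = D ; B = extraBlue ; R = extraRed ; shape = BarShape-swap shape
  ; R≢[] = Middle.extraRed≢[] mid
  ; m+1∉ = subst (λ z → suc m ∉ blueLabels z) P-eq (proj₂ (proj₂ (proj₂ first)))
  ; γ-eq = trans (proj₁ (proj₂ (proj₂ first))) (cong₂ (λ u v → u ++ bbar (suc m) ∷ v) P-eq Q-eq) }
  where
  open Normal (Middle.normal mid)
  first = firstBlueBar (suc m) γ
    (↭.∈-resp-↭ (↭-sym (Valid.blue-labels valid)) (∈-applyUpTo⁺ suc (n<1+n m)))
  runs = barRuns (proj₁ first) (bbar (suc m)) (proj₁ (proj₂ first)) body extraBlue extraRed body-noExtra tt
    (trans (sym (proj₁ (proj₂ (proj₂ first)))) eq)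
  open BarRuns runs

-- a blue bar must be followed by a bar
W₁≢[]-withBlueBar : ∀ m {A W₁ W₂ D} B R → BarShape A W₁ W₂ D →
  Linked Adjacent (withBlueBar m A W₁ R W₂ D B) → W₁ ≢ []
W₁≢[]-withBlueBar m {A} {W₂ = W₂} {D} B R sh l refl
  with subst (λ z → Linked Adjacent (bbar (suc m) ∷ z)) (head∷ʳ-eq D (extra B R)) (Linked-++⁻ʳ (A ++ W₂) _ l)
... | adj ∷ _ = blueBar-¬Adjacent-nonBar (suc m) _ (head∷ʳ-nonBar D _ (BarShape.D-headNotBar sh) refl) adj

module _ (m k n : ℕ) where

  private
    module FromDomain {α} (d : InDomain m (suc k) (suc n) α) where
      open PairShape (pairShape m (suc k) (suc n) α d) public
      valid-α : ValidBarred m (suc k) (suc n) (withPair m A W₁ R W₂ D B)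
      valid-α = subst (ValidBarred m (suc k) (suc n)) α-eq (Normal.valid (IsBarred⇒Normal m _ _ α (proj₁ d)))
      valid-γ = valid-withBlueBar m shape B R k n W₁≢[] valid-α
      ψb-α : ψb m α ≡ withBlueBar m A W₁ R W₂ D B
      ψb-α = trans (cong (ψb m) α-eq)
        (ψb-withPair m shape B R (m+1∉blueElems m shape B R k (Valid.blue-elems (proj₁ valid-γ))))

    module FromMiddle {γ} (mid : Middle m k n γ) where
      open BlueBarShape (blueBarShape m k n γ mid) public
      valid-γ : ValidMiddle m k n (withBlueBar m A W₁ R W₂ D B)
      valid-γ = subst (ValidMiddle m k n) γ-eq (Normal.valid (Middle.normal mid))
      unψb-γ : unψb m γ ≡ withPair m A W₁ R W₂ D B
      unψb-γ = trans (cong (unψb m) γ-eq) (unψb-withBlueBar m shape B R m+1∉)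

  ψb-middle : ∀ α → InDomain m (suc k) (suc n) α → Middle m k n (ψb m α)
  ψb-middle α d = subst (Middle m k n) (sym ψb-α)
    (record { normal = normal-withBlueBar m shape B R (proj₁ valid-γ) ; extraRed≢[] = proj₂ valid-γ })
    where open FromDomain d

  unψb-ψb : ∀ α → InDomain m (suc k) (suc n) α → unψb m (ψb m α) ≡ α
  unψb-ψb α d = begin
    unψb m (ψb m α)                      ≡⟨ cong (unψb m) ψb-α ⟩
    unψb m (withBlueBar m A W₁ R W₂ D B) ≡⟨ unψb-withBlueBar m shape B R m+1∉ ⟩
    withPair m A W₁ R W₂ D B             ≡⟨ sym α-eq ⟩
    α                                    ∎
    where
    open ≡-Reasoning
    open FromDomain d
    m+1∉ = m+1∉blueLabels m shape B R
      (labelsAtMost-↭ m m _ (Valid.blue-labels valid-α) (Valid.red-labels valid-α))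

  unψb-domain : ∀ γ → Middle m k n γ → InDomain m (suc k) (suc n) (unψb m γ)
  unψb-domain γ mid = subst (InDomain m (suc k) (suc n)) (sym unψb-γ)
    (inDomain-withPair m shape B R (suc k) (suc n) W₁≢[] (valid-withPair m shape B R k n R≢[] valid-γ))
    where
    open FromMiddle mid
    W₁≢[] = W₁≢[]-withBlueBar m B R shape (Valid.linked valid-γ)

  ψb-unψb : ∀ γ → Middle m k n γ → ψb m (unψb m γ) ≡ γ
  ψb-unψb γ mid = begin
    ψb m (unψb m γ)                   ≡⟨ cong (ψb m) unψb-γ ⟩
    ψb m (withPair m A W₁ R W₂ D B)   ≡⟨ ψb-withPair m shape B R m+1∉elems ⟩
    withBlueBar m A W₁ R W₂ D B       ≡⟨ sym γ-eq ⟩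
    γ                                 ∎
    where
    open ≡-Reasoning
    open FromMiddle mid
    m+1∉elems = m+1∉blueElems m shape B R k (Valid.blue-elems valid-γ)

-- The step ψ_r

-- ψ_r maps redInExtra to redBarExtra when m+1 is in the extra red block,
-- and redInPair to redBarPair when m+1 lies in the red block of the pair (Bᵢ, Rᵢ)
redInExtra redBarExtra : ℕ → Seq → List ℕ → List ℕ → Seq
redInExtra m X B R = X ++ extra B (suc m ∷ R) ∷ []
redBarExtra m X B R = X ++ rbar (suc m) ∷ extra B R ∷ []

redInPair redBarPair : ℕ → Seq → List ℕ → List ℕ → Seq → List ℕ → List ℕ → Seq
redInPair m X Bᵢ Rᵢ Y B R = X ++ pair Bᵢ (suc m ∷ Rᵢ) ∷ Y ++ extra B R ∷ []
redBarPair m X Bᵢ Rᵢ Y B R = X ++ rbar (suc m) ∷ pair Bᵢ R ∷ Y ++ extra B Rᵢ ∷ []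

unψr″ : ℕ → Seq → List ℕ → List ℕ → Seq → Maybe (List ℕ × List ℕ) → Seq
unψr″ a X Bᵢ R Y (just (_ , Rᵢ)) = setExtraRed R (X ++ pair Bᵢ (a ∷ Rᵢ) ∷ Y)
unψr″ a X Bᵢ R Y nothing = []

unψr′ : ℕ → Maybe (Seq × Seq) → Seq
unψr′ a (just (X , extra B R ∷ Z)) = X ++ extra B (a ∷ R) ∷ Z
unψr′ a (just (X , pair Bᵢ R ∷ Y)) = unψr″ a X Bᵢ R Y (getExtra Y)
unψr′ a _ = []

unψr : ℕ → Seq → Seq
unψr m β = unψr′ (suc m) (splitR (suc m) β)

ψr-redInExtra : ∀ m X B R → All NotExtra X → suc m ∉ R → ψr m (redInExtra m X B R) ≡ redBarExtra m X B R
ψr-redInExtra m X B R ne m+1∉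
  rewrite getExtra-last X B (suc m ∷ R) ne | elemᵇ-head (suc m) R
        | mapExtra-last (λ B R → rbar (suc m) ∷ extra B (removeᵇ (suc m) R) ∷ []) X B (suc m ∷ R) ne
        | removeᵇ-head (suc m) R m+1∉ = refl

unψr-redBarExtra : ∀ m X B R → suc m ∉ redLabels X → unψr m (redBarExtra m X B R) ≡ redInExtra m X B R
unψr-redBarExtra m X B R m+1∉ rewrite splitR-first (suc m) X (extra B R ∷ []) m+1∉ = refl

ψr-redInPair : ∀ m X Bᵢ Rᵢ Y B R → All NotExtra X → All NotExtra Y → suc m ∉ Rᵢ → suc m ∉ R →
  suc m ∉ redElems X → ψr m (redInPair m X Bᵢ Rᵢ Y B R) ≡ redBarPair m X Bᵢ Rᵢ Y B R
ψr-redInPair m X Bᵢ Rᵢ Y B R neX neY m+1∉Rᵢ m+1∉R m+1∉X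
  rewrite getExtra-hole X (pair Bᵢ (suc m ∷ Rᵢ)) [] Y B R (All.++⁺ neX (tt ∷ neY))
        | elemᵇ-false (suc m) R m+1∉R
        | findRedPair-first (suc m) X Bᵢ (suc m ∷ Rᵢ) (Y ++ extra B R ∷ []) (elemᵇ-head (suc m) Rᵢ) m+1∉X
        | removeᵇ-head (suc m) Rᵢ m+1∉Rᵢ
  = setExtraRed-hole Rᵢ X (rbar (suc m)) (pair Bᵢ R ∷ []) Y B R (All.++⁺ neX (tt ∷ tt ∷ neY))

unψr-redBarPair : ∀ m X Bᵢ Rᵢ Y B R → All NotExtra X → All NotExtra Y → suc m ∉ redLabels X →
  unψr m (redBarPair m X Bᵢ Rᵢ Y B R) ≡ redInPair m X Bᵢ Rᵢ Y B R
unψr-redBarPair m X Bᵢ Rᵢ Y B R neX neY m+1∉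
  rewrite splitR-first (suc m) X (pair Bᵢ R ∷ Y ++ extra B Rᵢ ∷ []) m+1∉
        | getExtra-last Y B Rᵢ neY
  = setExtraRed-hole R X (pair Bᵢ (suc m ∷ Rᵢ)) [] Y B Rᵢ (All.++⁺ neX (tt ∷ neY))

sorted-∷ : ∀ a L → (∀ {x} → x ∈ L → a < x) → Linked _<_ L → Linked _<_ (a ∷ L)
sorted-∷ a [] _ _ = [-]
sorted-∷ a (x ∷ L) a<L l = a<L (here refl) ∷ l

module _ (m k n : ℕ) (X : Seq) (B R : List ℕ) where
  private
    a = suc m
    γ = redInExtra m X B R
    β = redBarExtra m X B R

  redElems-redInExtra : redElems γ ↭ a ∷ redElems β
  redElems-redInExtra rewrite redElems-++ X (extra B (a ∷ R) ∷ []) | redElems-++ X (rbar a ∷ extra B R ∷ []) =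
    ↭.shift a (redElems X) (R ++ [])

  redLabels-redInExtra : redLabels β ≡ redLabels γ ∷ʳ a
  redLabels-redInExtra
    rewrite redLabels-++ X (rbar a ∷ extra B R ∷ []) | redLabels-++ X (extra B (a ∷ R) ∷ []) =
    cong (_∷ʳ a) (sym (++-identityʳ (redLabels X)))

  blue-redInExtra : blueElems β ≡ blueElems γ × blueLabels β ≡ blueLabels γ
  blue-redInExtra
    rewrite blueElems-++ X (rbar a ∷ extra B R ∷ []) | blueElems-++ X (extra B (a ∷ R) ∷ [])
          | blueLabels-++ X (rbar a ∷ extra B R ∷ []) | blueLabels-++ X (extra B (a ∷ R) ∷ []) = refl , refl

  valid-redBarExtra : ValidMiddle m k n γ → ValidBarred (suc m) k n β
  valid-redBarExtra v = record
    { items-ok = All.++⁺ okX (tt ∷ (proj₁ okE , Linked.tail (proj₂ okE)) ∷ [])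
    ; blue-elems = subst (_↭ range (suc m) k) (sym (proj₁ blue-redInExtra)) blue-elems
    ; red-elems = ↭.drop-∷ (↭-trans (↭-sym redElems-redInExtra) (subst (redElems γ ↭_) (range-suc m n) red-elems))
    ; blue-labels = subst (_↭ applyUpTo suc (suc m)) (sym (proj₂ blue-redInExtra)) blue-labels
    ; red-labels = subst₂ _↭_ (sym redLabels-redInExtra) (upTo-∷ʳ (suc m)) (↭.++⁺ʳ (a ∷ []) red-labels)
    ; linked = Linked-glue X (rbar a) (extra B R ∷ [])
        (Linked-replaceLast X (extra B (a ∷ R)) (rbar a)
          (λ x adj lab → Adjacent-nonBar⇒redBar a x _ refl adj lab (n<1+n m)) labX linked)
        (tt ∷ [-])
    }
    where
    open Valid v
    okX = All.++⁻ˡ X items-ok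
    okE = All.head (All.++⁻ʳ X items-ok)
    labX = All.++⁻ˡ X (labelsAtMost-↭ (suc m) m γ blue-labels red-labels)

  valid-redInExtra : (∀ {x} → x ∈ R → a < x) → ValidBarred (suc m) k n β → ValidMiddle m k n γ
  valid-redInExtra a<R v = record
    { items-ok = All.++⁺ okX ((proj₁ okE , sorted-∷ a R a<R (proj₂ okE)) ∷ [])
    ; blue-elems = subst (_↭ range (suc m) k) (proj₁ blue-redInExtra) blue-elems
    ; red-elems = subst (redElems γ ↭_) (sym (range-suc m n)) (↭-trans redElems-redInExtra (prep a red-elems))
    ; blue-labels = subst (_↭ applyUpTo suc (suc m)) (proj₂ blue-redInExtra) blue-labels
    ; red-labels = ∷ʳ-↭⁻ a (subst₂ _↭_ redLabels-redInExtra (sym (upTo-∷ʳ (suc m))) red-labels)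
    ; linked = Linked-replaceLast X (rbar a) (extra B (a ∷ R))
        (λ x adj lab → Adjacent-redBar⇒nonBar a x _ refl adj lab) labX
        (proj₁ (Linked-cut X (rbar a) (extra B R ∷ []) linked))
    }
    where
    open Valid v
    okX = All.++⁻ˡ X items-ok
    okE = All.head (All.tail (All.++⁻ʳ X items-ok))
    labX = All.++⁻ˡ X (labelsAtMost-↭ (suc m) (suc m) β blue-labels red-labels)

module _ (m k n : ℕ) (X : Seq) (Bᵢ Rᵢ : List ℕ) (Y : Seq) (B R : List ℕ) (neY : All NotExtra Y) where
  private
    a = suc m
    pᵢ = pair Bᵢ (a ∷ Rᵢ)
    p = pair Bᵢ R
    γ = redInPair m X Bᵢ Rᵢ Y B R
    β = redBarPair m X Bᵢ Rᵢ Y B R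

  blue-redInPair : blueElems β ≡ blueElems γ × blueLabels β ≡ blueLabels γ
  blue-redInPair
    rewrite blueElems-++ X (rbar a ∷ p ∷ Y ++ extra B Rᵢ ∷ []) | blueElems-++ X (pᵢ ∷ Y ++ extra B R ∷ [])
          | blueElems-++ Y (extra B Rᵢ ∷ []) | blueElems-++ Y (extra B R ∷ [])
          | blueLabels-++ X (rbar a ∷ p ∷ Y ++ extra B Rᵢ ∷ []) | blueLabels-++ X (pᵢ ∷ Y ++ extra B R ∷ [])
          | blueLabels-++ Y (extra B Rᵢ ∷ []) | blueLabels-++ Y (extra B R ∷ []) = refl , refl

  redElems-redInPair : redElems γ ↭ a ∷ redElems β
  redElems-redInPair
    rewrite redElems-++ X (rbar a ∷ p ∷ Y ++ extra B Rᵢ ∷ []) | redElems-++ X (pᵢ ∷ Y ++ extra B R ∷ [])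
          | redElems-++ Y (extra B Rᵢ ∷ []) | redElems-++ Y (extra B R ∷ []) =
    prove 6 (x ⊕ ((av ⊕ ri) ⊕ (y ⊕ (r ⊕ z)))) (av ⊕ (x ⊕ (r ⊕ (y ⊕ (ri ⊕ z)))))
      (redElems X ∷ (a ∷ []) ∷ Rᵢ ∷ redElems Y ∷ R ∷ [] ∷ [])
    where x = var zero ; av = var (suc zero) ; ri = var (suc (suc zero)) ; y = var (suc (suc (suc zero)))
          r = var (suc (suc (suc (suc zero)))) ; z = var (suc (suc (suc (suc (suc zero)))))

  redLabels-redInPair : redLabels β ↭ redLabels γ ∷ʳ a
  redLabels-redInPair
    rewrite redLabels-++ X (rbar a ∷ p ∷ Y ++ extra B Rᵢ ∷ []) | redLabels-++ X (pᵢ ∷ Y ++ extra B R ∷ [])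
          | redLabels-++ Y (extra B Rᵢ ∷ []) | redLabels-++ Y (extra B R ∷ []) =
    prove 4 (x ⊕ (av ⊕ (y ⊕ z))) ((x ⊕ (y ⊕ z)) ⊕ av) (redLabels X ∷ (a ∷ []) ∷ redLabels Y ∷ [] ∷ [])
    where x = var zero ; av = var (suc zero) ; y = var (suc (suc zero)) ; z = var (suc (suc (suc zero)))

  valid-redBarPair : R ≢ [] → ValidMiddle m k n γ → ValidBarred (suc m) k n β
  valid-redBarPair R≢[] v = record
    { items-ok = All.++⁺ okX (tt ∷ (proj₁ okP , R≢[] , proj₁ (proj₂ (proj₂ okP)) , proj₂ okE)
        ∷ All.++⁺ okY ((proj₁ okE , Linked.tail (proj₂ (proj₂ (proj₂ okP)))) ∷ []))
    ; blue-elems = subst (_↭ range (suc m) k) (sym (proj₁ blue-redInPair)) blue-elems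
    ; red-elems = ↭.drop-∷ (↭-trans (↭-sym redElems-redInPair) (subst (redElems γ ↭_) (range-suc m n) red-elems))
    ; blue-labels = subst (_↭ applyUpTo suc (suc m)) (sym (proj₂ blue-redInPair)) blue-labels
    ; red-labels = subst (redLabels β ↭_) (upTo-∷ʳ (suc m))
        (↭-trans redLabels-redInPair (↭.++⁺ʳ (a ∷ []) red-labels))
    ; linked = Linked-glue X (rbar a) (p ∷ Y ++ extra B Rᵢ ∷ [])
        (Linked-replaceLast X pᵢ (rbar a) (λ x adj lab → Adjacent-nonBar⇒redBar a x pᵢ refl adj lab (n<1+n m))
          labX (proj₁ cut))
        (tt ∷ Linked-∷-nonBar p _ refl (Linked-setExtraRed-last Rᵢ Y B R neY (Linked.tail (proj₂ cut))))
    }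
    where
    open Valid v
    okX = All.++⁻ˡ X items-ok
    okP = All.head (All.++⁻ʳ X items-ok)
    okY = All.++⁻ˡ Y (All.tail (All.++⁻ʳ X items-ok))
    okE = All.head (All.++⁻ʳ Y (All.tail (All.++⁻ʳ X items-ok)))
    labX = All.++⁻ˡ X (labelsAtMost-↭ (suc m) m γ blue-labels red-labels)
    cut = Linked-cut X pᵢ (Y ++ extra B R ∷ []) linked

  valid-redInPair : (∀ {x} → x ∈ Rᵢ → a < x) → ValidBarred (suc m) k n β → ValidMiddle m k n γ
  valid-redInPair a<Rᵢ v = record
    { items-ok = All.++⁺ okX
        ((proj₁ okP , (λ ()) , proj₁ (proj₂ (proj₂ okP)) , sorted-∷ a Rᵢ a<Rᵢ (proj₂ okE))
        ∷ All.++⁺ okY ((proj₁ okE , proj₂ (proj₂ (proj₂ okP))) ∷ []))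
    ; blue-elems = subst (_↭ range (suc m) k) (proj₁ blue-redInPair) blue-elems
    ; red-elems = subst (redElems γ ↭_) (sym (range-suc m n)) (↭-trans redElems-redInPair (prep a red-elems))
    ; blue-labels = subst (_↭ applyUpTo suc (suc m)) (proj₂ blue-redInPair) blue-labels
    ; red-labels = ∷ʳ-↭⁻ a (↭-trans (↭-sym redLabels-redInPair)
        (subst (redLabels β ↭_) (sym (upTo-∷ʳ (suc m))) red-labels))
    ; linked = Linked-glue X pᵢ (Y ++ extra B R ∷ [])
        (Linked-replaceLast X (rbar a) pᵢ (λ x adj lab → Adjacent-redBar⇒nonBar a x pᵢ refl adj lab) labX
          (proj₁ cut))
        (Linked-∷-nonBar pᵢ _ refl
          (Linked-setExtraRed-last R Y B Rᵢ neY (Linked.tail (Linked.tail (proj₂ cut)))))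
    }
    where
    open Valid v
    okX = All.++⁻ˡ X items-ok
    okP = All.head (All.tail (All.++⁻ʳ X items-ok))
    okY = All.++⁻ˡ Y (All.tail (All.tail (All.++⁻ʳ X items-ok)))
    okE = All.head (All.++⁻ʳ Y (All.tail (All.tail (All.++⁻ʳ X items-ok))))
    labX = All.++⁻ˡ X (labelsAtMost-↭ (suc m) (suc m) β blue-labels red-labels)
    cut = Linked-cut X (rbar a) (p ∷ Y ++ extra B Rᵢ ∷ []) linked

data RedStep (m : ℕ) (γ β : Seq) : Set where
  inExtra : ∀ X B R → All NotExtra X → suc m ∉ redLabels X → (∀ {x} → x ∈ R → suc m < x) →
    γ ≡ redInExtra m X B R → β ≡ redBarExtra m X B R → RedStep m γ β
  inPair : ∀ X Bᵢ Rᵢ Y B R → All NotExtra X → All NotExtra Y → suc m ∉ R → suc m ∉ redElems X →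
    suc m ∉ redLabels X → (∀ {x} → x ∈ Rᵢ → suc m < x) → R ≢ [] →
    γ ≡ redInPair m X Bᵢ Rᵢ Y B R → β ≡ redBarPair m X Bᵢ Rᵢ Y B R → RedStep m γ β

sorted-head : ∀ a L → Linked _<_ L → (∀ {x} → x ∈ L → a ≤ x) → a ∈ L →
  ∃ λ L′ → L ≡ a ∷ L′ × (∀ {x} → x ∈ L′ → a < x)
sorted-head a (r ∷ L) sorted a≤L (here refl) = L , refl , head<tail sorted
  where
  head<tail : ∀ {r L} → Linked _<_ (r ∷ L) → ∀ {x} → x ∈ L → r < x
  head<tail (r<y ∷ l) x∈ = All.lookup (Linked.Linked⇒All <-trans r<y l) x∈
sorted-head a (r ∷ L) (r<y ∷ l) a≤L (there a∈L) =
  ⊥-elim (<-irrefl refl (≤-<-trans (a≤L (here refl)) (All.lookup (Linked.Linked⇒All <-trans r<y l) a∈L)))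

module _ (m k n : ℕ) (γ : Seq) (mid : Middle m k n γ) where
  open Normal (Middle.normal mid)
  open Valid valid
  private
    a = suc m
    e = extra extraBlue extraRed
    a≤ : ∀ {x} → x ∈ redElems γ → a ≤ x
    a≤ x∈ = range⇒> m (suc n) (↭.∈-resp-↭ red-elems x∈)
    a∉labels : a ∉ redLabels body
    a∉labels a∈ = <-irrefl refl (∈-redLabels⇒≤ (labelsAtMost-↭ (suc m) m γ blue-labels red-labels)
      (subst (λ z → a ∈ redLabels z) (sym eq) (∈-redLabels-++⁺ˡ body (e ∷ []) a∈)))

  redStep-inExtra : a ∈ extraRed → ∃ λ β → RedStep m γ β
  redStep-inExtra a∈R = _ , inExtra body extraBlue (proj₁ head) body-noExtra a∉labels (proj₂ (proj₂ head))
    (trans eq (cong (λ r → body ∷ʳ extra extraBlue r) (proj₁ (proj₂ head)))) refl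
    where
    okE = All.head (All.++⁻ʳ body (subst (All ItemOK) eq items-ok))
    ∈R⇒∈γ : ∀ {x} → x ∈ extraRed → x ∈ redElems γ
    ∈R⇒∈γ x∈ = subst (λ z → _ ∈ redElems z) (sym eq) (∈-redElems-++⁺ʳ body (e ∷ []) (∈-++⁺ˡ x∈))
    head = sorted-head a extraRed (proj₂ okE) (λ x∈ → a≤ (∈R⇒∈γ x∈)) a∈R

  redStep-inPair : a ∉ extraRed → ∃ λ β → RedStep m γ β
  redStep-inPair a∉R = _ , inPair X Bᵢ (proj₁ head) Y extraBlue extraRed
    (All.++⁻ˡ X neXY) (All.tail (All.++⁻ʳ X neXY)) a∉R a∉X
    (λ a∈ → a∉labels (subst (λ z → a ∈ redLabels z) (sym body-eq) (∈-redLabels-++⁺ˡ X _ a∈)))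
    (proj₂ (proj₂ head)) (Middle.extraRed≢[] mid)
    (trans γ-eq (cong (λ r → X ++ pair Bᵢ r ∷ Y ++ e ∷ []) (proj₁ (proj₂ head)))) refl
    where
    a∈γ : a ∈ redElems (body ∷ʳ e)
    a∈γ = subst (λ z → a ∈ redElems z) eq
      (↭.∈-resp-↭ (↭-sym red-elems) (subst (a ∈_) (sym (range-suc m n)) (here refl)))
    a∈body : a ∈ redElems body
    a∈body with ∈-++⁻ (redElems body) (subst (a ∈_) (redElems-++ body (e ∷ [])) a∈γ)
    ... | inj₁ a∈ = a∈
    ... | inj₂ a∈ with ∈-++⁻ extraRed a∈
    ...   | inj₁ a∈R = ⊥-elim (a∉R a∈R)
    ...   | inj₂ ()
    first = firstRedPair a body body-noExtra a∈body
    X = proj₁ first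
    Bᵢ = proj₁ (proj₂ first)
    Rᵢ = proj₁ (proj₂ (proj₂ first))
    Y = proj₁ (proj₂ (proj₂ (proj₂ first)))
    body-eq = proj₁ (proj₂ (proj₂ (proj₂ (proj₂ first))))
    a∈Rᵢ = proj₁ (proj₂ (proj₂ (proj₂ (proj₂ (proj₂ first)))))
    a∉X = proj₂ (proj₂ (proj₂ (proj₂ (proj₂ (proj₂ first)))))
    neXY = subst (All NotExtra) body-eq body-noExtra
    γ-eq : γ ≡ X ++ pair Bᵢ Rᵢ ∷ Y ++ e ∷ []
    γ-eq = trans eq (trans (cong (_∷ʳ e) body-eq) (++-assoc X (pair Bᵢ Rᵢ ∷ Y) (e ∷ [])))
    okP = All.head (All.++⁻ʳ X (subst (All ItemOK) γ-eq items-ok))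
    ∈Rᵢ⇒∈γ : ∀ {x} → x ∈ Rᵢ → x ∈ redElems γ
    ∈Rᵢ⇒∈γ x∈ = subst (λ z → _ ∈ redElems z) (sym γ-eq)
      (∈-redElems-++⁺ʳ X (pair Bᵢ Rᵢ ∷ Y ++ e ∷ []) (∈-++⁺ˡ x∈))
    head = sorted-head a Rᵢ (proj₂ (proj₂ (proj₂ okP))) (λ x∈ → a≤ (∈Rᵢ⇒∈γ x∈)) a∈Rᵢ

redStep-middle : ∀ m k n γ → Middle m k n γ → ∃ λ β → RedStep m γ β
redStep-middle m k n γ mid with suc m ∈? Normal.extraRed (Middle.normal mid)
... | yes a∈R = redStep-inExtra m k n γ mid a∈R
... | no a∉R = redStep-inPair m k n γ mid a∉R

-- red bar a is the largest label, so what follows it is neither a bar nor (inside the body) the extra pair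
afterMaxRedBar : ∀ {a} z → Adjacent (rbar a) z → LabelsAtMost a a z → NotExtra z → ∃₂ λ B R → z ≡ pair B R
afterMaxRedBar (bbar j) a<j j≤a _ = ⊥-elim (<-irrefl refl (<-≤-trans a<j j≤a))
afterMaxRedBar (rbar j) a<j j≤a _ = ⊥-elim (<-irrefl refl (<-≤-trans a<j j≤a))
afterMaxRedBar (pair B R) _ _ _ = B , R , refl

module _ (m k n : ℕ) (β : Seq) (barred : IsBarred (suc m) k n β) where
  open Normal (IsBarred⇒Normal (suc m) k n β barred)
  open Valid valid
  private
    a = suc m
    e = extra extraBlue extraRed
    a< : ∀ {x} → x ∈ redElems β → a < x
    a< x∈ = range⇒> (suc m) n (↭.∈-resp-↭ red-elems x∈)
    first = firstRedBar a β (↭.∈-resp-↭ (↭-sym red-labels) (∈-upTo⁺ (n<1+n a)))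
    X = proj₁ first
    Z = proj₁ (proj₂ first)
    β-eq = proj₁ (proj₂ (proj₂ first))
    a∉X = proj₂ (proj₂ (proj₂ first))

  redStep-barExtra : Z ≡ e ∷ [] → body ≡ X ∷ʳ rbar a → ∃ λ γ → RedStep m γ β
  redStep-barExtra Z-eq body-eq = _ , inExtra X extraBlue extraRed neX a∉X a<R refl β′
    where
    β′ = trans β-eq (cong (λ z → X ++ rbar a ∷ z) Z-eq)
    neX = All.++⁻ˡ X (subst (All NotExtra) body-eq body-noExtra)
    a<R : ∀ {x} → x ∈ extraRed → a < x
    a<R x∈ = a< (subst (λ w → _ ∈ redElems w) (sym β′)
      (∈-redElems-++⁺ʳ X (rbar a ∷ e ∷ []) (∈-++⁺ˡ x∈)))

  redStep-barItem : ∀ z Z₁ → Z ≡ z ∷ Z₁ ++ e ∷ [] → body ≡ (X ∷ʳ rbar a) ++ z ∷ Z₁ →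
    ∃ λ γ → RedStep m γ β
  redStep-barItem z Z₁ Z-eq body-eq with afterMaxRedBar z adj lab (All.head neZ)
    where
    β′ = trans β-eq (cong (λ w → X ++ rbar a ∷ w) Z-eq)
    ne = subst (All NotExtra) (trans body-eq (++-assoc X (rbar a ∷ []) (z ∷ Z₁))) body-noExtra
    neZ = All.tail (All.++⁻ʳ X ne)
    adj = Linked.head (proj₂ (Linked-cut X (rbar a) _ (subst (Linked Adjacent) β′ linked)))
    lab = All.head (All.tail (All.++⁻ʳ X
      (subst (All (LabelsAtMost a a)) β′ (labelsAtMost-↭ a a β blue-labels red-labels))))
  ... | Bᵢ , R , refl = _ , inPair X Bᵢ extraRed Z₁ extraBlue R neX (All.tail neZ)
      (λ a∈ → <-irrefl refl (a< (inβ (∈-++⁺ˡ a∈))))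
      (λ a∈ → <-irrefl refl (a< (subst (λ w → a ∈ redElems w) (sym β′) (∈-redElems-++⁺ˡ X _ a∈))))
      a∉X
      (λ x∈ → a< (inβ (∈-++⁺ʳ R (∈-redElems-++⁺ʳ Z₁ (e ∷ []) (∈-++⁺ˡ x∈)))))
      (proj₁ (proj₂ okP)) refl β′
    where
    β′ = trans β-eq (cong (λ w → X ++ rbar a ∷ w) Z-eq)
    ne = subst (All NotExtra) (trans body-eq (++-assoc X (rbar a ∷ []) (pair Bᵢ R ∷ Z₁))) body-noExtra
    neX = All.++⁻ˡ X ne
    neZ = All.tail (All.++⁻ʳ X ne)
    okP = All.head (All.tail (All.++⁻ʳ X (subst (All ItemOK) β′ items-ok)))
    inβ : ∀ {x} → x ∈ redElems (pair Bᵢ R ∷ Z₁ ++ e ∷ []) → x ∈ redElems β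
    inβ x∈ = subst (λ w → _ ∈ redElems w) (sym β′)
      (∈-redElems-++⁺ʳ X (rbar a ∷ pair Bᵢ R ∷ Z₁ ++ e ∷ []) x∈)

  redStep-barred : ∃ λ γ → RedStep m γ β
  redStep-barred with ∷-hole-≡-∷ʳ X (rbar a) Z body e (λ ()) (trans (sym β-eq) eq)
  ... | [] , Z-eq , body-eq = redStep-barExtra Z-eq (trans body-eq (++-identityʳ _))
  ... | z ∷ Z₁ , Z-eq , body-eq = redStep-barItem z Z₁ Z-eq body-eq

module _ (m k n : ℕ) where

  private
    ψr-step : ∀ {γ β} → RedStep m γ β → ψr m γ ≡ β
    ψr-step (inExtra X B R neX _ a<R refl refl) =
      ψr-redInExtra m X B R neX (λ a∈ → <-irrefl refl (a<R a∈))
    ψr-step (inPair X Bᵢ Rᵢ Y B R neX neY a∉R a∉X _ a<Rᵢ _ refl refl) =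
      ψr-redInPair m X Bᵢ Rᵢ Y B R neX neY (λ a∈ → <-irrefl refl (a<Rᵢ a∈)) a∉R a∉X

    unψr-step : ∀ {γ β} → RedStep m γ β → unψr m β ≡ γ
    unψr-step (inExtra X B R _ a∉X _ refl refl) = unψr-redBarExtra m X B R a∉X
    unψr-step (inPair X Bᵢ Rᵢ Y B R neX neY _ _ a∉X _ _ refl refl) =
      unψr-redBarPair m X Bᵢ Rᵢ Y B R neX neY a∉X

    barred-step : ∀ {γ β} → RedStep m γ β → ValidMiddle m k n γ → IsBarred (suc m) k n β
    barred-step (inExtra X B R neX _ _ refl refl) v = Normal⇒IsBarred (suc m) k n _ record
      { body = X ∷ʳ rbar (suc m) ; extraBlue = B ; extraRed = R ; eq = sym (++-assoc X (rbar (suc m) ∷ []) _)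
      ; body-noExtra = All.++⁺ neX (tt ∷ []) ; valid = valid-redBarExtra m k n X B R v }
    barred-step (inPair X Bᵢ Rᵢ Y B R neX neY _ _ _ _ R≢[] refl refl) v = Normal⇒IsBarred (suc m) k n _ record
      { body = X ++ rbar (suc m) ∷ pair Bᵢ R ∷ Y ; extraBlue = B ; extraRed = Rᵢ
      ; eq = reassoc-last X (rbar (suc m)) (pair Bᵢ R ∷ []) Y _
      ; body-noExtra = All.++⁺ neX (tt ∷ tt ∷ neY) ; valid = valid-redBarPair m k n X Bᵢ Rᵢ Y B R neY R≢[] v }

    middle-step : ∀ {γ β} → RedStep m γ β → ValidBarred (suc m) k n β → Middle m k n γ
    middle-step (inExtra X B R neX _ a<R refl refl) v = record
      { normal = record { body = X ; extraBlue = B ; extraRed = suc m ∷ R ; eq = refl ; body-noExtra = neX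
                        ; valid = valid-redInExtra m k n X B R a<R v }
      ; extraRed≢[] = λ () }
    middle-step (inPair X Bᵢ Rᵢ Y B R neX neY _ _ _ a<Rᵢ R≢[] refl refl) v = record
      { normal = record { body = X ++ pair Bᵢ (suc m ∷ Rᵢ) ∷ Y ; extraBlue = B ; extraRed = R
                        ; eq = reassoc-last X (pair Bᵢ (suc m ∷ Rᵢ)) [] Y _
                        ; body-noExtra = All.++⁺ neX (tt ∷ neY)
                        ; valid = valid-redInPair m k n X Bᵢ Rᵢ Y B R neY a<Rᵢ v }
      ; extraRed≢[] = R≢[] }

  ψr-barred : ∀ γ → Middle m k n γ → IsBarred (suc m) k n (ψr m γ)
  ψr-barred γ mid with redStep-middle m k n γ mid
  ... | β , step = subst (IsBarred (suc m) k n) (sym (ψr-step step)) (barred-step step (Normal.valid (Middle.normal mid)))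

  unψr-ψr : ∀ γ → Middle m k n γ → unψr m (ψr m γ) ≡ γ
  unψr-ψr γ mid with redStep-middle m k n γ mid
  ... | β , step = trans (cong (unψr m) (ψr-step step)) (unψr-step step)

  unψr-middle : ∀ β → IsBarred (suc m) k n β → Middle m k n (unψr m β)
  unψr-middle β barred with redStep-barred m k n β barred
  ... | γ , step = subst (Middle m k n) (sym (unψr-step step))
    (middle-step step (Normal.valid (IsBarred⇒Normal (suc m) k n β barred)))

  ψr-unψr : ∀ β → IsBarred (suc m) k n β → ψr m (unψr m β) ≡ β
  ψr-unψr β barred with redStep-barred m k n β barred
  ... | γ , step = trans (cong (ψr m) (unψr-step step)) (ψr-step step)

mainTheorem6 : (m k n : ℕ) →
    ((α : Seq) → InDomain m (suc k) (suc n) α → IsBarred (suc m) k n (ψ m α))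
    × ((α α′ : Seq) → InDomain m (suc k) (suc n) α → InDomain m (suc k) (suc n) α′ →
         ψ m α ≡ ψ m α′ → α ≡ α′)
    × ((β : Seq) → IsBarred (suc m) k n β →
         Σ Seq (λ α → InDomain m (suc k) (suc n) α × ψ m α ≡ β))
mainTheorem6 m k n = maps-to , injective , surjective
  where
  unψ : Seq → Seq
  unψ β = unψb m (unψr m β)

  unψ-ψ : ∀ α → InDomain m (suc k) (suc n) α → unψ (ψ m α) ≡ α
  unψ-ψ α d = trans (cong (unψb m) (unψr-ψr m k n _ (ψb-middle m k n α d))) (unψb-ψb m k n α d)

  maps-to : ∀ α → InDomain m (suc k) (suc n) α → IsBarred (suc m) k n (ψ m α)
  maps-to α d = ψr-barred m k n (ψb m α) (ψb-middle m k n α d)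

  injective : ∀ α α′ → InDomain m (suc k) (suc n) α → InDomain m (suc k) (suc n) α′ →
    ψ m α ≡ ψ m α′ → α ≡ α′
  injective α α′ d d′ eq = trans (sym (unψ-ψ α d)) (trans (cong unψ eq) (unψ-ψ α′ d′))

  surjective : ∀ β → IsBarred (suc m) k n β → Σ Seq (λ α → InDomain m (suc k) (suc n) α × ψ m α ≡ β)
  surjective β barred = unψ β , unψb-domain m k n _ middle ,
    trans (cong (ψr m) (ψb-unψb m k n _ middle)) (ψr-unψr m k n β barred)
    where middle = unψr-middle m k n β barred
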